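{- Let $H=(V,E)$ be a hypergraph with all hyperedges nonempty, and let $\xi(H;x,y,z)$ be its hyperedge elimination polynomial. Then: (1) $\xi(E_0;x,y,z)=1$, where $E_0$ is the hypergraph with no vertices and no edges; (2) $\xi(E_1;x,y,z)=x$, where $E_1$ is the hypergraph with one vertex and no edges; (3) $\xi(H_1\sqcup H_2;x,y,z)=\xi(H_1;x,y,z)\cdot\xi(H_2;x,y,z)$ for a disjoint union of hypergraphs; (4) for every edge $e$ of $H$, $\xi(H;x,y,z)=\xi(H-e;x,y,z)+y\,\xi(H/e;x,y,z)+z\,\xi(H\dagger e;x,y,z)$.
   Context: A hypergraph $H=(V,E)$ has finite vertex set $V$ and finite indexed family $E=(e_i)_{i\in I}$ of subsets of $V$ (parallel edges allowed); here all hyperedges are nonempty. For $J\subseteq I$, $H_J=(V,(e_j)_{j\in J})$ is the partial hypergraph and $H\times J$ the edge section hypergraph with vertex set $\bigcup_{j\in J}e_j$ and edges $(e_j)_{j\in J}$. $k(G)$ is the number of connected components of a hypergraph $G$ (a hypergraph without vertices has $0$). A pair $(A,B)$ of disjoint subsets of $I$ is vertex disjoint if $e_a\cap e_b=\emptyset$ for all $a\in A,b\in B$. Then $\xi(H;x,y,z)=\sum_{(A,B)}x^{k(H_{A\sqcup B})-k(H\times B)}y^{|A|+|B|-k(H\times B)}z^{k(H\times B)}$, summed over vertex disjoint pairs. For an edge $e_i$: deletion $H-e_i=(V,(e_j)_{j\neq i})$; extraction $H\dagger e_i=(V\setminus e_i,(e_j)_{j\neq i,\ e_j\cap e_i=\emptyset})$;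 contraction $H/e_i$ has vertex set $(V\setminus e_i)\cup\{v_i\}$ with $v_i$ new and edges indexed by $j\neq i$, equal to $e_j$ if $e_j\cap e_i=\emptyset$ and to $(e_j\setminus e_i)\cup\{v_i\}$ otherwise. -}

module Defs where

open import Level using (Level)
open import Data.Nat using (ℕ; zero; suc; _∸_) renaming (_+_ to _+ℕ_)
open import Data.Bool using (Bool; true; false; _∧_; _∨_; not; if_then_else_)
open import Data.Fin using (Fin; zero; suc)
open import Data.Vec using (Vec; []; _∷_; replicate; zipWith; _++_)
import Data.Vec as Vec
open import Data.List using (List; []; _∷_; length; concatMap; foldr; map; removeAt)
import Data.List as List
open import Data.List.Relation.Unary.All using (All)
open import Data.Product using (_×_; _,_)
open import Data.Maybe using (Maybe; just; nothing)
open import Data.Fin.Subset using (Subset; _⊆_; Nonempty)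
open import Algebra.Bundles using (CommutativeSemiring)
open import Relation.Nullary using (does)
import Data.Fin as Fin

-- Hypergraphs.  The vertex set is a subset V of an ambient Fin n,
-- hyperedges are an indexed family given by a list (position = index;
-- parallel edges allowed) of subsets of Fin n.

record Hypergraph : Set where
  constructor hg
  field
    n : ℕ
    V : Subset n
    E : List (Subset n)
open Hypergraph public

WellFormed : Hypergraph → Set
WellFormed H = All (λ e → e ⊆ V H) (E H) × All Nonempty (E H)

_∩ᵇ_ : ∀ {n} → Subset n → Subset n → Subset n
_∩ᵇ_ = zipWith _∧_

_∪ᵇ_ : ∀ {n} → Subset n → Subset n → Subset n
_∪ᵇ_ = zipWith _∨_

_∖ᵇ_ : ∀ {n} → Subset n → Subset n → Subset n
s ∖ᵇ t = zipWith (λ a b → a ∧ not b) s t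

anyᵇ : ∀ {n} → Subset n → Bool
anyᵇ [] = false
anyᵇ (b ∷ s) = b ∨ anyᵇ s

meets : ∀ {n} → Subset n → Subset n → Bool
meets s t = anyᵇ (s ∩ᵇ t)

emptySet : ∀ {n} → Subset n
emptySet = replicate _ false

single : ∀ {n} → Fin n → Subset n
single zero = true ∷ emptySet
single (suc i) = false ∷ single i

bigUnion : ∀ {n} → List (Subset n) → Subset n
bigUnion = foldr _∪ᵇ_ emptySet

minElem : ∀ {n} → Subset n → Maybe (Fin n)
minElem [] = nothing
minElem (true ∷ s) = just zero
minElem (false ∷ s) = Data.Maybe.map suc (minElem s)

sameFin : ∀ {n} → Maybe (Fin n) → Fin n → Bool
sameFin nothing i = false
sameFin (just j) i = does (j Fin.≟ i)

filterᵇ : ∀ {A : Set} → (A → Bool) → List A → List A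
filterᵇ p [] = []
filterᵇ p (a ∷ as) = if p a then a ∷ filterᵇ p as else filterᵇ p as

-- Connected components.
-- step Es R adds to R every edge of Es meeting R; iterating n times
-- from {v} yields the connected component of v (a component has at
-- most n vertices, and each non-final step adds a vertex).

step : ∀ {n} → List (Subset n) → Subset n → Subset n
step Es R = R ∪ᵇ bigUnion (filterᵇ (λ e → meets e R) Es)

iter : ∀ {A : Set} → ℕ → (A → A) → A → A
iter zero f a = a
iter (suc k) f a = f (iter k f a)

component : ∀ {n} → List (Subset n) → Fin n → Subset n
component {n} Es v = iter n (step Es) (single v)

isRoot : ∀ {n} → Subset n → List (Subset n) → Fin n → Bool
isRoot W Es v = Vec.lookup W v ∧ sameFin (minElem (component Es v)) v

-- k(G): number of connected components of the hypergraph with vertex set W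
-- and edges Es (0 if W is empty).
kComp : ∀ {n} → Subset n → List (Subset n) → ℕ
kComp {n} W Es = length (filterᵇ (λ v → isRoot W Es v) (List.allFin n))

-- All pairs (A , B) of disjoint sub-families of the edge family:
-- each edge goes to A, to B, or to neither (3^m pairs, indexed).

pairs : ∀ {n} → List (Subset n) → List (List (Subset n) × List (Subset n))
pairs [] = ([] , []) ∷ []
pairs (e ∷ es) =
  concatMap (λ { (A , B) → (A , B) ∷ (e ∷ A , B) ∷ (A , e ∷ B) ∷ [] }) (pairs es)

allᵇ : ∀ {A : Set} → (A → Bool) → List A → Bool
allᵇ p = foldr (λ a r → p a ∧ r) true

vertexDisjoint : ∀ {n} → List (Subset n) → List (Subset n) → Bool
vertexDisjoint A B = allᵇ (λ a → allᵇ (λ b → not (meets a b)) B) A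

module Poly {c ℓ : Level} (R : CommutativeSemiring c ℓ) where
  open CommutativeSemiring R

  pow : Carrier → ℕ → Carrier
  pow a zero = 1#
  pow a (suc k) = a * pow a k

  term : ∀ {n} → Subset n → Carrier → Carrier → Carrier →
         List (Subset n) × List (Subset n) → Carrier
  term W x y z (A , B) =
    if vertexDisjoint A B
    then pow x (kComp W (A List.++ B) ∸ kB)
         * (pow y (length (A List.++ B) ∸ kB) * pow z kB)
    else 0#
    where kB = kComp (bigUnion B) B

  ξ : Hypergraph → Carrier → Carrier → Carrier → Carrier
  ξ (hg n W Es) x y z = foldr (λ p r → term W x y z p + r) 0# (pairs Es)

E₀ : Hypergraph
E₀ = hg 0 [] []

E₁ : Hypergraph
E₁ = hg 1 (true ∷ []) []

_⊔ᴴ_ : Hypergraph → Hypergraph → Hypergraph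
hg n₁ V₁ E₁' ⊔ᴴ hg n₂ V₂ E₂' =
  hg (n₁ +ℕ n₂) (V₁ ++ V₂)
     (map (λ e → e ++ replicate n₂ false) E₁' List.++ map (λ e → replicate n₁ false ++ e) E₂')

EdgeIx : Hypergraph → Set
EdgeIx H = Fin (length (E H))

edge : (H : Hypergraph) → EdgeIx H → Subset (n H)
edge H i = List.lookup (E H) i

delete : (H : Hypergraph) → EdgeIx H → Hypergraph
delete (hg n W Es) i = hg n W (removeAt Es i)

extract : (H : Hypergraph) → EdgeIx H → Hypergraph
extract (hg n W Es) i =
  hg n (W ∖ᵇ e) (filterᵇ (λ f → not (meets f e)) (removeAt Es i))
  where e = List.lookup Es i

-- contraction H / e_i: ambient set Fin (suc n); the new vertex v_i is zero,
-- old vertex j becomes suc j.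
contract : (H : Hypergraph) → EdgeIx H → Hypergraph
contract (hg n W Es) i =
  hg (suc n) (true ∷ (W ∖ᵇ e))
     (map (λ f → if meets f e then true ∷ (f ∖ᵇ e) else false ∷ f) (removeAt Es i))
  where e = List.lookup Es i

module Submission where

-- Each summand of ξ is indexed by a pair (A , B), and both identities are bookkeeping of the
-- numbers k(H_{A⊔B}), |A| + |B| and k(H × B). For a disjoint union all three are additive over
-- the two parts, so every summand, and hence the sum, factorises. For the recurrence, sort the
-- pairs of H by the position of e. Pairs not using e are the pairs of H − e. Contracting an edge
-- does not change the number of components, so a pair with e ∈ A, or with e ∈ B and some edge of
-- B meeting e, contributes y times the term of the contracted pair in H / e, and these contracted
-- pairs are exactly the vertex disjoint pairs of H / e. A pair with e ∈ B and no edge meeting e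
-- has e as an extra component of both H_{A⊔B} and H × B, and contributes z times its term in H † e.

open import Defs
open import Level using (Level)
open import Algebra.Bundles using (CommutativeSemiring)
import Algebra.Properties.CommutativeSemigroup as CommSemigroupProps
import Algebra.Solver.CommutativeMonoid as CommMonoidSolver
open import Data.Bool using (Bool; true; false; _∧_; _∨_; not; if_then_else_)
import Data.Bool.Properties as BoolP
open import Data.Empty using (⊥-elim)
open import Data.Fin as Fin using (Fin; zero; suc; _↑ˡ_; _↑ʳ_)
import Data.Fin.Properties as FinP
open import Data.Fin.Subset as FinSubset using (Subset)
open import Data.List as List using (List; []; _∷_; length; map)
import Data.List.Properties as ListP
open import Data.List.Membership.Propositional using (_∈_)
open import Data.List.Membership.Propositional.Properties
  using (∈-map⁺; ∈-map⁻; ∈-++⁺ˡ; ∈-++⁺ʳ; ∈-++⁻; ∈-lookup)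
open import Data.List.Relation.Binary.Permutation.Propositional
  using (_↭_; prep; swap; ↭-refl; ↭-sym)
import Data.List.Relation.Binary.Permutation.Propositional as Perm
import Data.List.Relation.Binary.Permutation.Propositional.Properties as PermP
open import Data.List.Relation.Binary.Subset.Propositional using () renaming (_⊆_ to _⊆ˡ_)
open import Data.List.Relation.Unary.All as All using (All; []; _∷_)
import Data.List.Relation.Unary.All.Properties as AllP
open import Data.List.Relation.Unary.Any using (here; there)
open import Data.Maybe as Maybe using (Maybe; just; nothing)
open import Data.Nat using (ℕ; zero; suc; _≤_; _<_; z≤n; s≤s; _∸_) renaming (_+_ to _+ℕ_)
import Data.Nat.Properties as ℕP
open import Data.Product using (_×_; _,_; ∃; proj₁; proj₂; map₁)
open import Data.Sum using (_⊎_; inj₁; inj₂)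
open import Data.Vec using (Vec; []; _∷_; lookup; replicate; _++_)
import Data.Vec.Properties as VecP
open import Relation.Binary.PropositionalEquality
  using (_≡_; _≢_; refl; sym; trans; cong; cong₂; subst; subst₂; module ≡-Reasoning)
open import Relation.Nullary using (yes; no)

true≢false : true ≢ false
true≢false ()

∨-true⁻ : ∀ {a b} → a ∨ b ≡ true → a ≡ true ⊎ b ≡ true
∨-true⁻ {true} _ = inj₁ refl
∨-true⁻ {false} h = inj₂ h

∧-true⁻ : ∀ {a b} → a ∧ b ≡ true → a ≡ true × b ≡ true
∧-true⁻ {true} {true} _ = refl , refl

∧-true⁺ : ∀ {a b} → a ≡ true → b ≡ true → a ∧ b ≡ true
∧-true⁺ refl refl = refl

∨-true⁺ˡ : ∀ {a} b → a ≡ true → a ∨ b ≡ true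
∨-true⁺ˡ b refl = refl

∨-true⁺ʳ : ∀ a {b} → b ≡ true → a ∨ b ≡ true
∨-true⁺ʳ a refl = BoolP.∨-zeroʳ a

not-true⁻ : ∀ {b} → not b ≡ true → b ≡ false
not-true⁻ {false} _ = refl

bool-ext : ∀ {a b} → (a ≡ true → b ≡ true) → (b ≡ true → a ≡ true) → a ≡ b
bool-ext {true} f g = sym (f refl)
bool-ext {false} {false} f g = refl
bool-ext {false} {true} f g = g refl

boolToℕ : Bool → ℕ
boolToℕ true = 1
boolToℕ false = 0

boolToℕ≤1 : ∀ b → boolToℕ b ≤ 1
boolToℕ≤1 true = ℕP.≤-refl
boolToℕ≤1 false = z≤n

boolToℕ-mono : ∀ {a b} → (a ≡ true → b ≡ true) → boolToℕ a ≤ boolToℕ b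
boolToℕ-mono {false} h = z≤n
boolToℕ-mono {true} h rewrite h refl = ℕP.≤-refl

boolToℕ-partition : ∀ a b → boolToℕ a ≡ boolToℕ (a ∧ b) +ℕ boolToℕ (a ∧ not b)
boolToℕ-partition true true = refl
boolToℕ-partition true false = refl
boolToℕ-partition false b = refl

-- Subsets of Fin n as Boolean vectors

_⊆ᵇ_ : ∀ {n} → Subset n → Subset n → Set
s ⊆ᵇ t = ∀ u → lookup s u ≡ true → lookup t u ≡ true

lookup-ext : ∀ {A : Set} {n} (s t : Vec A n) → (∀ i → lookup s i ≡ lookup t i) → s ≡ t
lookup-ext s t h =
  trans (sym (VecP.tabulate∘lookup s)) (trans (VecP.tabulate-cong h) (VecP.tabulate∘lookup t))

lookup-∪ : ∀ {n} (s t : Subset n) u → lookup (s ∪ᵇ t) u ≡ (lookup s u ∨ lookup t u)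
lookup-∪ s t u = VecP.lookup-zipWith _∨_ u s t

lookup-∩ : ∀ {n} (s t : Subset n) u → lookup (s ∩ᵇ t) u ≡ (lookup s u ∧ lookup t u)
lookup-∩ s t u = VecP.lookup-zipWith _∧_ u s t

lookup-∖ : ∀ {n} (s t : Subset n) u → lookup (s ∖ᵇ t) u ≡ (lookup s u ∧ not (lookup t u))
lookup-∖ s t u = VecP.lookup-zipWith _ u s t

lookup-∖-true⁻ : ∀ {n} (s t : Subset n) u → lookup (s ∖ᵇ t) u ≡ true → lookup s u ≡ true × lookup t u ≡ false
lookup-∖-true⁻ s t u h with ∧-true⁻ (trans (sym (lookup-∖ s t u)) h)
... | su , tu = su , not-true⁻ tu

lookup-∖-true⁺ : ∀ {n} (s t : Subset n) u → lookup s u ≡ true → lookup t u ≡ false → lookup (s ∖ᵇ t) u ≡ true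
lookup-∖-true⁺ s t u su tu = trans (lookup-∖ s t u) (∧-true⁺ su (cong not tu))

lookup-∖-member : ∀ {n} (s t : Subset n) u → lookup t u ≡ true → lookup (s ∖ᵇ t) u ≡ false
lookup-∖-member s t u tu = trans (lookup-∖ s t u) (trans (cong (λ b → lookup s u ∧ not b) tu) (BoolP.∧-zeroʳ _))

lookup-∖-nonmember : ∀ {n} (s t : Subset n) u → lookup t u ≡ false → lookup (s ∖ᵇ t) u ≡ lookup s u
lookup-∖-nonmember s t u tu = trans (lookup-∖ s t u) (trans (cong (λ b → lookup s u ∧ not b) tu) (BoolP.∧-identityʳ _))

lookup-∅ : ∀ {n} (u : Fin n) → lookup emptySet u ≡ false
lookup-∅ u = VecP.lookup-replicate u false

lookup-single⇒≡ : ∀ {n} (v u : Fin n) → lookup (single v) u ≡ true → v ≡ u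
lookup-single⇒≡ zero zero _ = refl
lookup-single⇒≡ zero (suc u) h = ⊥-elim (true≢false (trans (sym h) (lookup-∅ u)))
lookup-single⇒≡ (suc v) (suc u) h = cong suc (lookup-single⇒≡ v u h)

lookup-single-self : ∀ {n} (v : Fin n) → lookup (single v) v ≡ true
lookup-single-self zero = refl
lookup-single-self (suc v) = lookup-single-self v

anyᵇ-true⁻ : ∀ {n} (s : Subset n) → anyᵇ s ≡ true → ∃ λ u → lookup s u ≡ true
anyᵇ-true⁻ (true ∷ s) _ = zero , refl
anyᵇ-true⁻ (false ∷ s) h with anyᵇ-true⁻ s h
... | u , su = suc u , su

anyᵇ-true⁺ : ∀ {n} (s : Subset n) u → lookup s u ≡ true → anyᵇ s ≡ true
anyᵇ-true⁺ (true ∷ s) zero _ = refl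
anyᵇ-true⁺ (b ∷ s) (suc u) h = ∨-true⁺ʳ b (anyᵇ-true⁺ s u h)

anyᵇ-++ : ∀ {n₁ n₂} (s : Subset n₁) (t : Subset n₂) → anyᵇ (s ++ t) ≡ (anyᵇ s ∨ anyᵇ t)
anyᵇ-++ [] t = refl
anyᵇ-++ (b ∷ s) t = trans (cong (b ∨_) (anyᵇ-++ s t)) (sym (BoolP.∨-assoc b _ _))

anyᵇ-∅ : ∀ n → anyᵇ (replicate n false) ≡ false
anyᵇ-∅ zero = refl
anyᵇ-∅ (suc n) = anyᵇ-∅ n

meets-true⁻ : ∀ {n} (s t : Subset n) → meets s t ≡ true → ∃ λ u → lookup s u ≡ true × lookup t u ≡ true
meets-true⁻ s t h with anyᵇ-true⁻ (s ∩ᵇ t) h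
... | u , p = u , ∧-true⁻ (trans (sym (lookup-∩ s t u)) p)

meets-true⁺ : ∀ {n} (s t : Subset n) u → lookup s u ≡ true → lookup t u ≡ true → meets s t ≡ true
meets-true⁺ s t u p q = anyᵇ-true⁺ (s ∩ᵇ t) u (trans (lookup-∩ s t u) (∧-true⁺ p q))

meets-false⁻ : ∀ {n} (s t : Subset n) u → meets s t ≡ false → lookup s u ≡ true → lookup t u ≡ false
meets-false⁻ s t u h su = BoolP.¬-not λ tu → true≢false (trans (sym (meets-true⁺ s t u su tu)) h)

meets-comm : ∀ {n} (s t : Subset n) → meets s t ≡ meets t s
meets-comm s t = bool-ext (swapped s t) (swapped t s)
  where
  swapped : ∀ s t → meets s t ≡ true → meets t s ≡ true
  swapped s t h with meets-true⁻ s t h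
  ... | u , su , tu = meets-true⁺ t s u tu su

meets-∅ : ∀ {n} (s : Subset n) → meets s emptySet ≡ false
meets-∅ s = BoolP.¬-not λ h → let (u , _ , ∅u) = meets-true⁻ s emptySet h in true≢false (trans (sym ∅u) (lookup-∅ u))

covers : ∀ {n} → List (Subset n) → Fin n → Bool
covers [] u = false
covers (e ∷ L) u = lookup e u ∨ covers L u

lookup-bigUnion : ∀ {n} (L : List (Subset n)) u → lookup (bigUnion L) u ≡ covers L u
lookup-bigUnion [] u = lookup-∅ u
lookup-bigUnion (e ∷ L) u = trans (lookup-∪ e (bigUnion L) u) (cong (lookup e u ∨_) (lookup-bigUnion L u))

covers-true⁻ : ∀ {n} (L : List (Subset n)) u → covers L u ≡ true → ∃ λ e → e ∈ L × lookup e u ≡ true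
covers-true⁻ (e ∷ L) u h with ∨-true⁻ {lookup e u} h
... | inj₁ eu = e , here refl , eu
... | inj₂ Lu with covers-true⁻ L u Lu
...   | f , f∈L , fu = f , there f∈L , fu

covers-true⁺ : ∀ {n} {e} (L : List (Subset n)) u → e ∈ L → lookup e u ≡ true → covers L u ≡ true
covers-true⁺ (f ∷ L) u (here refl) h = ∨-true⁺ˡ _ h
covers-true⁺ (f ∷ L) u (there e∈L) h = ∨-true⁺ʳ (lookup f u) (covers-true⁺ L u e∈L h)

covers-++ : ∀ {n} (xs ys : List (Subset n)) u → covers (xs List.++ ys) u ≡ (covers xs u ∨ covers ys u)
covers-++ [] ys u = refl
covers-++ (x ∷ xs) ys u = trans (cong (lookup x u ∨_) (covers-++ xs ys u)) (sym (BoolP.∨-assoc (lookup x u) _ _))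

covers-↭ : ∀ {n} {xs ys : List (Subset n)} → xs ↭ ys → ∀ u → covers xs u ≡ covers ys u
covers-↭ Perm.refl u = refl
covers-↭ (prep x p) u = cong (lookup x u ∨_) (covers-↭ p u)
covers-↭ (swap x y p) u = begin
  lookup x u ∨ (lookup y u ∨ _) ≡⟨ sym (BoolP.∨-assoc (lookup x u) (lookup y u) _) ⟩
  (lookup x u ∨ lookup y u) ∨ _ ≡⟨ cong₂ _∨_ (BoolP.∨-comm (lookup x u) (lookup y u)) (covers-↭ p u) ⟩
  (lookup y u ∨ lookup x u) ∨ _ ≡⟨ BoolP.∨-assoc (lookup y u) (lookup x u) _ ⟩
  lookup y u ∨ (lookup x u ∨ _) ∎
  where open ≡-Reasoning
covers-↭ (Perm.trans p q) u = trans (covers-↭ p u) (covers-↭ q u)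

∈⇒⊆bigUnion : ∀ {n} {L : List (Subset n)} {g} → g ∈ L → g ⊆ᵇ bigUnion L
∈⇒⊆bigUnion {L = L} g∈L u gu = trans (lookup-bigUnion L u) (covers-true⁺ L u g∈L gu)

bigUnion-↭ : ∀ {n} {xs ys : List (Subset n)} → xs ↭ ys → bigUnion xs ≡ bigUnion ys
bigUnion-↭ {xs = xs} {ys} p =
  lookup-ext _ _ λ u → trans (lookup-bigUnion xs u) (trans (covers-↭ p u) (sym (lookup-bigUnion ys u)))

∈-filterᵇ⁻ : ∀ {A : Set} (p : A → Bool) {x} L → x ∈ filterᵇ p L → x ∈ L × p x ≡ true
∈-filterᵇ⁻ p (a ∷ L) x∈ with p a in pa
∈-filterᵇ⁻ p (a ∷ L) (here refl) | true = here refl , pa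
∈-filterᵇ⁻ p (a ∷ L) (there x∈) | true = map₁ there (∈-filterᵇ⁻ p L x∈)
... | false = map₁ there (∈-filterᵇ⁻ p L x∈)

∈-filterᵇ⁺ : ∀ {A : Set} (p : A → Bool) {x} L → x ∈ L → p x ≡ true → x ∈ filterᵇ p L
∈-filterᵇ⁺ p (a ∷ L) x∈ px with p a in pa
∈-filterᵇ⁺ p (a ∷ L) (here refl) px | true = here refl
∈-filterᵇ⁺ p (a ∷ L) (there x∈) px | true = there (∈-filterᵇ⁺ p L x∈ px)
∈-filterᵇ⁺ p (a ∷ L) (here refl) px | false = ⊥-elim (true≢false (trans (sym px) pa))
∈-filterᵇ⁺ p (a ∷ L) (there x∈) px | false = ∈-filterᵇ⁺ p L x∈ px

filterᵇ-++ : ∀ {A : Set} (p : A → Bool) xs ys → filterᵇ p (xs List.++ ys) ≡ filterᵇ p xs List.++ filterᵇ p ys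
filterᵇ-++ p [] ys = refl
filterᵇ-++ p (x ∷ xs) ys with p x
... | true = cong (x ∷_) (filterᵇ-++ p xs ys)
... | false = filterᵇ-++ p xs ys

filterᵇ-map : ∀ {A B : Set} (p : B → Bool) (f : A → B) xs → filterᵇ p (map f xs) ≡ map f (filterᵇ (λ x → p (f x)) xs)
filterᵇ-map p f [] = refl
filterᵇ-map p f (x ∷ xs) with p (f x)
... | true = cong (f x ∷_) (filterᵇ-map p f xs)
... | false = filterᵇ-map p f xs

filterᵇ-cong : ∀ {A : Set} {p q : A → Bool} → (∀ x → p x ≡ q x) → ∀ xs → filterᵇ p xs ≡ filterᵇ q xs
filterᵇ-cong h [] = refl
filterᵇ-cong {q = q} h (x ∷ xs) rewrite h x with q x
... | true = cong (x ∷_) (filterᵇ-cong h xs)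
... | false = filterᵇ-cong h xs

filterᵇ-none : ∀ {A : Set} (p : A → Bool) xs → (∀ x → p x ≡ false) → filterᵇ p xs ≡ []
filterᵇ-none p [] h = refl
filterᵇ-none p (x ∷ xs) h rewrite h x = filterᵇ-none p xs h

allᵇ-true⁻ : ∀ {A : Set} (p : A → Bool) {x} xs → allᵇ p xs ≡ true → x ∈ xs → p x ≡ true
allᵇ-true⁻ p (y ∷ xs) h (here refl) = proj₁ (∧-true⁻ h)
allᵇ-true⁻ p (y ∷ xs) h (there x∈) = allᵇ-true⁻ p xs (proj₂ (∧-true⁻ {p y} h)) x∈

allᵇ-false⁻ : ∀ {A : Set} (p : A → Bool) xs → allᵇ p xs ≡ false → ∃ λ x → x ∈ xs × p x ≡ false
allᵇ-false⁻ p (x ∷ xs) h with p x in px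
... | false = x , here refl , px
... | true with allᵇ-false⁻ p xs h
...   | y , y∈ , py = y , there y∈ , py

allᵇ-++ : ∀ {A : Set} (p : A → Bool) xs ys → allᵇ p (xs List.++ ys) ≡ (allᵇ p xs ∧ allᵇ p ys)
allᵇ-++ p [] ys = refl
allᵇ-++ p (x ∷ xs) ys = trans (cong (p x ∧_) (allᵇ-++ p xs ys)) (sym (BoolP.∧-assoc (p x) _ _))

allᵇ-map : ∀ {A B : Set} (p : B → Bool) (f : A → B) xs → allᵇ p (map f xs) ≡ allᵇ (λ x → p (f x)) xs
allᵇ-map p f [] = refl
allᵇ-map p f (x ∷ xs) = cong (p (f x) ∧_) (allᵇ-map p f xs)

allᵇ-cong : ∀ {A : Set} {p q : A → Bool} → (∀ x → p x ≡ q x) → ∀ xs → allᵇ p xs ≡ allᵇ q xs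
allᵇ-cong h [] = refl
allᵇ-cong h (x ∷ xs) = cong₂ _∧_ (h x) (allᵇ-cong h xs)

allᵇ-const-true : ∀ {A : Set} (xs : List A) → allᵇ (λ _ → true) xs ≡ true
allᵇ-const-true [] = refl
allᵇ-const-true (x ∷ xs) = allᵇ-const-true xs

allᵇ-∧ : ∀ {A : Set} (p q : A → Bool) xs → allᵇ (λ x → p x ∧ q x) xs ≡ (allᵇ p xs ∧ allᵇ q xs)
allᵇ-∧ p q [] = refl
allᵇ-∧ p q (x ∷ xs) rewrite allᵇ-∧ p q xs with p x | q x
... | true | true = refl
... | true | false = sym (BoolP.∧-zeroʳ _)
... | false | _ = refl

allᵇ-∨ʳ : ∀ {A : Set} (p : A → Bool) b xs → allᵇ (λ x → p x ∨ b) xs ≡ (allᵇ p xs ∨ b)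
allᵇ-∨ʳ p true xs =
  trans (allᵇ-cong (λ x → BoolP.∨-zeroʳ (p x)) xs) (trans (allᵇ-const-true xs) (sym (BoolP.∨-zeroʳ _)))
allᵇ-∨ʳ p false xs = trans (allᵇ-cong (λ x → BoolP.∨-identityʳ (p x)) xs) (sym (BoolP.∨-identityʳ _))

allᵇ-∨ˡ : ∀ {A : Set} b (p : A → Bool) xs → allᵇ (λ x → b ∨ p x) xs ≡ (b ∨ allᵇ p xs)
allᵇ-∨ˡ b p xs = trans (allᵇ-cong (λ x → BoolP.∨-comm b (p x)) xs) (trans (allᵇ-∨ʳ p b xs) (BoolP.∨-comm _ b))

allᵇ-↭ : ∀ {A : Set} (p : A → Bool) {xs ys} → xs ↭ ys → allᵇ p xs ≡ allᵇ p ys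
allᵇ-↭ p Perm.refl = refl
allᵇ-↭ p (prep x q) = cong (p x ∧_) (allᵇ-↭ p q)
allᵇ-↭ p (swap x y q) = begin
  p x ∧ (p y ∧ _) ≡⟨ sym (BoolP.∧-assoc (p x) (p y) _) ⟩
  (p x ∧ p y) ∧ _ ≡⟨ cong₂ _∧_ (BoolP.∧-comm (p x) (p y)) (allᵇ-↭ p q) ⟩
  (p y ∧ p x) ∧ _ ≡⟨ BoolP.∧-assoc (p y) (p x) _ ⟩
  p y ∧ (p x ∧ _) ∎
  where open ≡-Reasoning
allᵇ-↭ p (Perm.trans q r) = trans (allᵇ-↭ p q) (allᵇ-↭ p r)

count : ∀ {n} → (Fin n → Bool) → ℕ
count {zero} f = 0
count {suc n} f = boolToℕ (f zero) +ℕ count (λ i → f (suc i))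

count-cong : ∀ {n} {f g : Fin n → Bool} → (∀ i → f i ≡ g i) → count f ≡ count g
count-cong {zero} h = refl
count-cong {suc n} h = cong₂ _+ℕ_ (cong boolToℕ (h zero)) (count-cong (λ i → h (suc i)))

count-mono : ∀ {n} (f g : Fin n → Bool) → (∀ u → f u ≡ true → g u ≡ true) → count f ≤ count g
count-mono {zero} f g h = z≤n
count-mono {suc n} f g h = ℕP.+-mono-≤ (boolToℕ-mono (h zero)) (count-mono _ _ (λ u → h (suc u)))

length-filterᵇ-tabulate : ∀ {n} {A : Set} (p : A → Bool) (f : Fin n → A) →
  length (filterᵇ p (List.tabulate f)) ≡ count (λ i → p (f i))
length-filterᵇ-tabulate {zero} p f = refl
length-filterᵇ-tabulate {suc n} p f with p (f zero)
... | true = cong suc (length-filterᵇ-tabulate p (λ i → f (suc i)))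
... | false = length-filterᵇ-tabulate p (λ i → f (suc i))

count-splitAt : ∀ n₁ {n₂} (f : Fin (n₁ +ℕ n₂) → Bool) →
  count f ≡ count (λ i → f (i ↑ˡ n₂)) +ℕ count (λ j → f (n₁ ↑ʳ j))
count-splitAt zero f = refl
count-splitAt (suc n₁) f =
  trans (cong (boolToℕ (f zero) +ℕ_) (count-splitAt n₁ (λ i → f (suc i)))) (sym (ℕP.+-assoc (boolToℕ (f zero)) _ _))

count-partition : ∀ {n} (f g : Fin n → Bool) → count f ≡ count (λ u → f u ∧ g u) +ℕ count (λ u → f u ∧ not (g u))
count-partition {zero} f g = refl
count-partition {suc n} f g =
  trans (cong₂ _+ℕ_ (boolToℕ-partition (f zero) (g zero)) (count-partition (λ u → f (suc u)) (λ u → g (suc u))))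
        (CommSemigroupProps.interchange ℕP.+-commutativeSemigroup
           (boolToℕ (f zero ∧ g zero)) (boolToℕ (f zero ∧ not (g zero))) _ _)

count-none : ∀ {n} (f : Fin n → Bool) → (∀ u → f u ≡ false) → count f ≡ 0
count-none {zero} f h = refl
count-none {suc n} f h rewrite h zero = count-none (λ u → f (suc u)) (λ u → h (suc u))

count-unique : ∀ {n} (f : Fin n → Bool) r → f r ≡ true → (∀ u → f u ≡ true → u ≡ r) → count f ≡ 1
count-unique {suc n} f zero fr h rewrite fr =
  cong suc (count-none (λ u → f (suc u)) (λ u → BoolP.¬-not (λ fu → FinP.0≢1+n (sym (h (suc u) fu)))))
count-unique {suc n} f (suc r) fr h with f zero in f0
... | true = ⊥-elim (FinP.0≢1+n (h zero f0))
... | false = count-unique (λ u → f (suc u)) r fr (λ u fu → FinP.suc-injective (h (suc u) fu))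

-- Connectivity and components

data Connected {n} (Es : List (Subset n)) : Fin n → Fin n → Set where
  ε : ∀ {u} → Connected Es u u
  hop : ∀ {u w v} (e : Subset n) → e ∈ Es → lookup e u ≡ true → lookup e w ≡ true →
        Connected Es w v → Connected Es u v

module _ {n} {Es : List (Subset n)} where

  Connected-trans : ∀ {a b c} → Connected Es a b → Connected Es b c → Connected Es a c
  Connected-trans ε q = q
  Connected-trans (hop e e∈ ea ew p) q = hop e e∈ ea ew (Connected-trans p q)

  Connected-edge : ∀ {a b} e → e ∈ Es → lookup e a ≡ true → lookup e b ≡ true → Connected Es a b
  Connected-edge e e∈ ea eb = hop e e∈ ea eb ε

  Connected-sym : ∀ {a b} → Connected Es a b → Connected Es b a
  Connected-sym ε = ε
  Connected-sym (hop e e∈ ea ew p) = Connected-trans (Connected-sym p) (Connected-edge e e∈ ew ea)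

  Connected-preserves : ∀ (W : Subset n) → (∀ {g} → g ∈ Es → g ⊆ᵇ W) →
    ∀ {a b} → lookup W a ≡ true → Connected Es a b → lookup W b ≡ true
  Connected-preserves W Es⊆W Wa ε = Wa
  Connected-preserves W Es⊆W Wa (hop g g∈ ga gw p) = Connected-preserves W Es⊆W (Es⊆W g∈ _ gw) p

Connected-mono : ∀ {n} {L L' : List (Subset n)} → L ⊆ˡ L' → ∀ {a b} → Connected L a b → Connected L' a b
Connected-mono L⊆L' ε = ε
Connected-mono L⊆L' (hop g g∈ ga gw p) = hop g (L⊆L' g∈) ga gw (Connected-mono L⊆L' p)

lookup-step : ∀ {n} (Es : List (Subset n)) R u →
  lookup (step Es R) u ≡ (lookup R u ∨ covers (filterᵇ (λ e → meets e R) Es) u)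
lookup-step Es R u =
  trans (lookup-∪ R _ u) (cong (lookup R u ∨_) (lookup-bigUnion (filterᵇ (λ e → meets e R) Es) u))

step-inflationary : ∀ {n} (Es : List (Subset n)) R → R ⊆ᵇ step Es R
step-inflationary Es R u Ru = trans (lookup-step Es R u) (∨-true⁺ˡ _ Ru)

step-sound : ∀ {n} (Es : List (Subset n)) R u → lookup (step Es R) u ≡ true →
  lookup R u ≡ true ⊎ (∃ λ w → lookup R w ≡ true × Connected Es w u)
step-sound Es R u h with ∨-true⁻ (trans (sym (lookup-step Es R u)) h)
... | inj₁ Ru = inj₁ Ru
... | inj₂ cov with covers-true⁻ _ u cov
...   | f , f∈ , fu with ∈-filterᵇ⁻ _ Es f∈
...     | f∈Es , fR with meets-true⁻ f R fR
...       | w , fw , Rw = inj₂ (w , Rw , Connected-edge f f∈Es fw fu)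

step-fixed⇒closed : ∀ {n} (Es : List (Subset n)) R → step Es R ≡ R →
  ∀ {a u} → lookup R a ≡ true → Connected Es a u → lookup R u ≡ true
step-fixed⇒closed Es R fixed Ra ε = Ra
step-fixed⇒closed Es R fixed {a} Ra (hop f f∈ fa fw p) = step-fixed⇒closed Es R fixed Rw p
  where
  Rw = trans (sym (cong (λ S → lookup S _) fixed))
         (trans (lookup-step Es R _) (∨-true⁺ʳ (lookup R _)
           (covers-true⁺ _ _ (∈-filterᵇ⁺ _ Es f∈ (meets-true⁺ f R a fa Ra)) fw)))

iterate-step-sound : ∀ {n} (Es : List (Subset n)) v k u →
  lookup (iter k (step Es) (single v)) u ≡ true → Connected Es v u
iterate-step-sound Es v zero u h = subst (Connected Es v) (lookup-single⇒≡ v u h) ε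
iterate-step-sound Es v (suc k) u h with step-sound Es (iter k (step Es) (single v)) u h
... | inj₁ p = iterate-step-sound Es v k u p
... | inj₂ (w , Rw , p) = Connected-trans (iterate-step-sound Es v k w Rw) p

size : ∀ {n} → Subset n → ℕ
size [] = 0
size (b ∷ s) = boolToℕ b +ℕ size s

size≤n : ∀ {n} (s : Subset n) → size s ≤ n
size≤n [] = z≤n
size≤n (b ∷ s) = ℕP.+-mono-≤ (boolToℕ≤1 b) (size≤n s)

size-∅ : ∀ n → size (replicate n false) ≡ 0
size-∅ zero = refl
size-∅ (suc n) = size-∅ n

size-single : ∀ {n} (v : Fin n) → size (single v) ≡ 1
size-single {suc n} zero = cong suc (size-∅ n)
size-single (suc v) = size-single v

size-⊂ : ∀ {n} (r s : Subset n) → r ⊆ᵇ s → r ≢ s → size r < size s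
size-⊂ [] [] r⊆s r≢s = ⊥-elim (r≢s refl)
size-⊂ (a ∷ r) (b ∷ s) r⊆s r≢s with VecP.≡-dec BoolP._≟_ r s
size-⊂ (a ∷ r) (b ∷ s) r⊆s r≢s | no r'≢s' =
  ℕP.+-mono-≤-< (boolToℕ-mono (r⊆s zero)) (size-⊂ r s (λ u → r⊆s (suc u)) r'≢s')
size-⊂ (a ∷ r) (b ∷ .r) r⊆s r≢s | yes refl with a | b | r⊆s zero
... | true | true | _ = ⊥-elim (r≢s refl)
... | false | false | _ = ⊥-elim (r≢s refl)
... | false | true | _ = ℕP.≤-refl
... | true | false | a⊆b = ⊥-elim (true≢false (sym (a⊆b refl)))

-- An inflationary map on subsets of Fin n, started from a nonempty set, strictly grows
-- until it stabilises, so n iterations always reach a fixed point.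
module Stabilise {n} (f : Subset n → Subset n) (inflationary : ∀ R → R ⊆ᵇ f R)
                 (R₀ : Subset n) (nonempty : 1 ≤ size R₀) where

  fixed-or-large : ∀ k → f (iter k f R₀) ≡ iter k f R₀ ⊎ suc k ≤ size (iter k f R₀)
  fixed-or-large zero = inj₂ nonempty
  fixed-or-large (suc k) with fixed-or-large k
  ... | inj₁ fixed = inj₁ (cong f fixed)
  ... | inj₂ large with VecP.≡-dec BoolP._≟_ (f (iter k f R₀)) (iter k f R₀)
  ...   | yes fixed = inj₁ (cong f fixed)
  ...   | no moved = inj₂ (ℕP.<-≤-trans (s≤s large) (size-⊂ _ _ (inflationary _) (λ e → moved (sym e))))

  fixed-after-n : f (iter n f R₀) ≡ iter n f R₀
  fixed-after-n with fixed-or-large n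
  ... | inj₁ fixed = fixed
  ... | inj₂ large = ⊥-elim (ℕP.<-irrefl refl (ℕP.≤-trans large (size≤n (iter n f R₀))))

  fixed-stays : ∀ k → f (iter k f R₀) ≡ iter k f R₀ → ∀ m → iter (m +ℕ k) f R₀ ≡ iter k f R₀
  fixed-stays k fixed zero = refl
  fixed-stays k fixed (suc m) = trans (cong f (fixed-stays k fixed m)) fixed

  iterate-inflationary : ∀ k → R₀ ⊆ᵇ iter k f R₀
  iterate-inflationary zero u h = h
  iterate-inflationary (suc k) u h = inflationary _ u (iterate-inflationary k u h)

module ComponentIteration {n} (Es : List (Subset n)) (v : Fin n) =
  Stabilise (step Es) (step-inflationary Es) (single v) (ℕP.≤-reflexive (sym (size-single v)))

component-fixed : ∀ {n} (Es : List (Subset n)) v → step Es (component Es v) ≡ component Es v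
component-fixed Es v = ComponentIteration.fixed-after-n Es v

component-self : ∀ {n} (Es : List (Subset n)) v → lookup (component Es v) v ≡ true
component-self {n} Es v = ComponentIteration.iterate-inflationary Es v n v (lookup-single-self v)

iterate-beyond-component : ∀ {n} (Es : List (Subset n)) v m → iter (m +ℕ n) (step Es) (single v) ≡ component Es v
iterate-beyond-component {n} Es v = ComponentIteration.fixed-stays Es v n (component-fixed Es v)

component-complete : ∀ {n} (Es : List (Subset n)) v u → Connected Es v u → lookup (component Es v) u ≡ true
component-complete Es v u = step-fixed⇒closed Es _ (component-fixed Es v) (component-self Es v)

component-sound : ∀ {n} (Es : List (Subset n)) v u → lookup (component Es v) u ≡ true → Connected Es v u
component-sound {n} Es v u = iterate-step-sound Es v n u

component-ext : ∀ {n} (Es Fs : List (Subset n)) v w →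
  (∀ u → Connected Es v u → Connected Fs w u) → (∀ u → Connected Fs w u → Connected Es v u) →
  component Es v ≡ component Fs w
component-ext Es Fs v w to from = lookup-ext _ _ λ u → bool-ext
  (λ h → component-complete Fs w u (to u (component-sound Es v u h)))
  (λ h → component-complete Es v u (from u (component-sound Fs w u h)))

Connected⇒component-≡ : ∀ {n} (Es : List (Subset n)) a b → Connected Es a b → component Es a ≡ component Es b
Connected⇒component-≡ Es a b a~b = component-ext Es Es a b
  (λ u a~u → Connected-trans (Connected-sym a~b) a~u) (λ u b~u → Connected-trans a~b b~u)

sameFin-true⁻ : ∀ {n} (m : Maybe (Fin n)) v → sameFin m v ≡ true → m ≡ just v
sameFin-true⁻ (just j) v h with j Fin.≟ v
... | yes refl = refl

sameFin-self : ∀ {n} (v : Fin n) → sameFin (just v) v ≡ true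
sameFin-self v with v Fin.≟ v
... | yes _ = refl
... | no v≢v = ⊥-elim (v≢v refl)

sameFin-map : ∀ {n m} (f : Fin n → Fin m) → (∀ a b → f a ≡ f b → a ≡ b) →
  ∀ (mb : Maybe (Fin n)) v → sameFin (Maybe.map f mb) (f v) ≡ sameFin mb v
sameFin-map f f-inj nothing v = refl
sameFin-map f f-inj (just j) v with j Fin.≟ v | f j Fin.≟ f v
... | yes refl | yes _ = refl
... | yes refl | no fj≢fj = ⊥-elim (fj≢fj refl)
... | no j≢v | yes fj≡fv = ⊥-elim (j≢v (f-inj j v fj≡fv))
... | no _ | no _ = refl

minElem-member : ∀ {n} (s : Subset n) j → minElem s ≡ just j → lookup s j ≡ true
minElem-member (true ∷ s) zero refl = refl
minElem-member (false ∷ s) j h with minElem s in eq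
minElem-member (false ∷ s) .(suc k) refl | just k = minElem-member s k eq

minElem-nonempty : ∀ {n} (s : Subset n) u → lookup s u ≡ true → ∃ λ j → minElem s ≡ just j
minElem-nonempty (true ∷ s) u h = zero , refl
minElem-nonempty (false ∷ s) (suc u) h with minElem-nonempty s u h
... | j , eq rewrite eq = suc j , refl

minElem-zero : ∀ {n} (s : Subset (suc n)) → lookup s zero ≡ true → minElem s ≡ just zero
minElem-zero (true ∷ s) h = refl

minElem-∅ : ∀ n → minElem (replicate n false) ≡ nothing
minElem-∅ zero = refl
minElem-∅ (suc n) rewrite minElem-∅ n = refl

minElem-++ˡ : ∀ {n₁} n₂ (s : Subset n₁) → minElem (s ++ replicate n₂ false) ≡ Maybe.map (_↑ˡ n₂) (minElem s)
minElem-++ˡ n₂ [] = minElem-∅ n₂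
minElem-++ˡ n₂ (true ∷ s) = refl
minElem-++ˡ n₂ (false ∷ s) rewrite minElem-++ˡ n₂ s with minElem s
... | just j = refl
... | nothing = refl

minElem-++ʳ : ∀ n₁ {n₂} (s : Subset n₂) → minElem (replicate n₁ false ++ s) ≡ Maybe.map (n₁ ↑ʳ_) (minElem s)
minElem-++ʳ zero s with minElem s
... | just j = refl
... | nothing = refl
minElem-++ʳ (suc n₁) s rewrite minElem-++ʳ n₁ s with minElem s
... | just j = refl
... | nothing = refl

kComp≡count-isRoot : ∀ {n} (W : Subset n) Es → kComp W Es ≡ count (isRoot W Es)
kComp≡count-isRoot W Es = length-filterᵇ-tabulate (isRoot W Es) (λ i → i)

kComp-cong-components : ∀ {n} (W : Subset n) (Es Fs : List (Subset n)) →
  (∀ v → component Es v ≡ component Fs v) → kComp W Es ≡ kComp W Fs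
kComp-cong-components W Es Fs same = begin
  kComp W Es ≡⟨ kComp≡count-isRoot W Es ⟩
  count (isRoot W Es) ≡⟨ count-cong (λ v → cong (λ C → lookup W v ∧ sameFin (minElem C) v) (same v)) ⟩
  count (isRoot W Fs) ≡⟨ sym (kComp≡count-isRoot W Fs) ⟩
  kComp W Fs ∎
  where open ≡-Reasoning

kComp-resp-⊆ˡ : ∀ {n} (W : Subset n) {Es Fs : List (Subset n)} → Es ⊆ˡ Fs → Fs ⊆ˡ Es → kComp W Es ≡ kComp W Fs
kComp-resp-⊆ˡ W {Es} {Fs} Es⊆Fs Fs⊆Es = kComp-cong-components W Es Fs λ v →
  component-ext Es Fs v v (λ u → Connected-mono Es⊆Fs) (λ u → Connected-mono Fs⊆Es)

kComp-resp-↭ : ∀ {n} (W : Subset n) {Es Fs : List (Subset n)} → Es ↭ Fs → kComp W Es ≡ kComp W Fs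
kComp-resp-↭ W p = kComp-resp-⊆ˡ W (PermP.∈-resp-↭ p) (PermP.∈-resp-↭ (↭-sym p))

-- Disjoint unions

embedˡ : ∀ {n₁} n₂ → Subset n₁ → Subset (n₁ +ℕ n₂)
embedˡ n₂ e = e ++ replicate n₂ false

embedʳ : ∀ n₁ {n₂} → Subset n₂ → Subset (n₁ +ℕ n₂)
embedʳ n₁ e = replicate n₁ false ++ e

_⊔ᴱ_ : ∀ {n₁ n₂} → List (Subset n₁) → List (Subset n₂) → List (Subset (n₁ +ℕ n₂))
_⊔ᴱ_ {n₁} {n₂} X₁ X₂ = map (embedˡ n₂) X₁ List.++ map (embedʳ n₁) X₂

replicate-+ : ∀ {A : Set} (x : A) a b → replicate (a +ℕ b) x ≡ replicate a x ++ replicate b x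
replicate-+ x zero b = refl
replicate-+ x (suc a) b = cong (x ∷_) (replicate-+ x a b)

single-↑ˡ : ∀ {n₁} n₂ (i : Fin n₁) → single (i ↑ˡ n₂) ≡ embedˡ n₂ (single i)
single-↑ˡ {suc n₁} n₂ zero = cong (true ∷_) (replicate-+ false n₁ n₂)
single-↑ˡ n₂ (suc i) = cong (false ∷_) (single-↑ˡ n₂ i)

single-↑ʳ : ∀ n₁ {n₂} (j : Fin n₂) → single (n₁ ↑ʳ j) ≡ embedʳ n₁ (single j)
single-↑ʳ zero j = refl
single-↑ʳ (suc n₁) j = cong (false ∷_) (single-↑ʳ n₁ j)

∪ᵇ-∅ˡ : ∀ {n} (s : Subset n) → emptySet ∪ᵇ s ≡ s
∪ᵇ-∅ˡ = VecP.zipWith-identityˡ BoolP.∨-identityˡ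

∪ᵇ-∅ʳ : ∀ {n} (s : Subset n) → s ∪ᵇ emptySet ≡ s
∪ᵇ-∅ʳ = VecP.zipWith-identityʳ BoolP.∨-identityʳ

meets-++ : ∀ {n₁ n₂} (s₁ t₁ : Subset n₁) (s₂ t₂ : Subset n₂) →
  meets (s₁ ++ s₂) (t₁ ++ t₂) ≡ (meets s₁ t₁ ∨ meets s₂ t₂)
meets-++ s₁ t₁ s₂ t₂ = trans (cong anyᵇ (VecP.zipWith-++ _∧_ s₁ s₂ t₁ t₂)) (anyᵇ-++ (s₁ ∩ᵇ t₁) (s₂ ∩ᵇ t₂))

meets-∅ˡ : ∀ {n} (s : Subset n) → meets emptySet s ≡ false
meets-∅ˡ s = trans (meets-comm emptySet s) (meets-∅ s)

meets-embedˡ : ∀ {n₁} n₂ (e R₁ : Subset n₁) (R₂ : Subset n₂) → meets (embedˡ n₂ e) (R₁ ++ R₂) ≡ meets e R₁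
meets-embedˡ n₂ e R₁ R₂ =
  trans (meets-++ e R₁ (replicate n₂ false) R₂) (trans (cong (meets e R₁ ∨_) (meets-∅ˡ R₂)) (BoolP.∨-identityʳ _))

meets-embedʳ : ∀ n₁ {n₂} (e R₂ : Subset n₂) (R₁ : Subset n₁) → meets (embedʳ n₁ e) (R₁ ++ R₂) ≡ meets e R₂
meets-embedʳ n₁ e R₂ R₁ = trans (meets-++ (replicate n₁ false) R₁ e R₂) (cong (_∨ meets e R₂) (meets-∅ˡ R₁))

bigUnion-++ : ∀ {n} (xs ys : List (Subset n)) → bigUnion (xs List.++ ys) ≡ bigUnion xs ∪ᵇ bigUnion ys
bigUnion-++ [] ys = sym (∪ᵇ-∅ˡ (bigUnion ys))
bigUnion-++ (x ∷ xs) ys =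
  trans (cong (x ∪ᵇ_) (bigUnion-++ xs ys)) (sym (VecP.zipWith-assoc BoolP.∨-assoc x (bigUnion xs) (bigUnion ys)))

bigUnion-embedˡ : ∀ {n₁} n₂ (X : List (Subset n₁)) → bigUnion (map (embedˡ n₂) X) ≡ embedˡ n₂ (bigUnion X)
bigUnion-embedˡ {n₁} n₂ [] = replicate-+ false n₁ n₂
bigUnion-embedˡ n₂ (e ∷ X) = trans (cong (embedˡ n₂ e ∪ᵇ_) (bigUnion-embedˡ n₂ X))
  (trans (VecP.zipWith-++ _∨_ e _ (bigUnion X) _) (cong (_ ++_) (∪ᵇ-∅ˡ (replicate n₂ false))))

bigUnion-embedʳ : ∀ n₁ {n₂} (X : List (Subset n₂)) → bigUnion (map (embedʳ n₁) X) ≡ embedʳ n₁ (bigUnion X)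
bigUnion-embedʳ n₁ {n₂} [] = replicate-+ false n₁ n₂
bigUnion-embedʳ n₁ (e ∷ X) = trans (cong (embedʳ n₁ e ∪ᵇ_) (bigUnion-embedʳ n₁ X))
  (trans (VecP.zipWith-++ _∨_ _ e _ (bigUnion X)) (cong (_++ _) (∪ᵇ-∅ˡ (replicate n₁ false))))

bigUnion-⊔ᴱ : ∀ {n₁ n₂} (X₁ : List (Subset n₁)) (X₂ : List (Subset n₂)) →
  bigUnion (X₁ ⊔ᴱ X₂) ≡ bigUnion X₁ ++ bigUnion X₂
bigUnion-⊔ᴱ {n₁} {n₂} X₁ X₂ = begin
  bigUnion (X₁ ⊔ᴱ X₂)
    ≡⟨ bigUnion-++ (map (embedˡ n₂) X₁) _ ⟩
  bigUnion (map (embedˡ n₂) X₁) ∪ᵇ bigUnion (map (embedʳ n₁) X₂)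
    ≡⟨ cong₂ _∪ᵇ_ (bigUnion-embedˡ n₂ X₁) (bigUnion-embedʳ n₁ X₂) ⟩
  embedˡ n₂ (bigUnion X₁) ∪ᵇ embedʳ n₁ (bigUnion X₂)
    ≡⟨ VecP.zipWith-++ _∨_ (bigUnion X₁) _ _ (bigUnion X₂) ⟩
  (bigUnion X₁ ∪ᵇ emptySet) ++ (emptySet ∪ᵇ bigUnion X₂)
    ≡⟨ cong₂ _++_ (∪ᵇ-∅ʳ (bigUnion X₁)) (∪ᵇ-∅ˡ (bigUnion X₂)) ⟩
  bigUnion X₁ ++ bigUnion X₂ ∎
  where open ≡-Reasoning

step-∅ : ∀ {n} (X : List (Subset n)) → step X emptySet ≡ emptySet
step-∅ X = trans (cong (λ F → emptySet ∪ᵇ bigUnion F) (filterᵇ-none _ X (λ e → meets-∅ e))) (∪ᵇ-∅ˡ emptySet)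

iterate-step-∅ : ∀ {n} (X : List (Subset n)) k → iter k (step X) emptySet ≡ emptySet
iterate-step-∅ X zero = refl
iterate-step-∅ X (suc k) = trans (cong (step X) (iterate-step-∅ X k)) (step-∅ X)

module DisjointUnion {n₁ n₂ : ℕ} (X₁ : List (Subset n₁)) (X₂ : List (Subset n₂)) where

  filter-meets-⊔ᴱ : ∀ R₁ R₂ → filterᵇ (λ e → meets e (R₁ ++ R₂)) (X₁ ⊔ᴱ X₂) ≡
    filterᵇ (λ e → meets e R₁) X₁ ⊔ᴱ filterᵇ (λ e → meets e R₂) X₂
  filter-meets-⊔ᴱ R₁ R₂ = trans (filterᵇ-++ _ (map (embedˡ n₂) X₁) _) (cong₂ List._++_
    (trans (filterᵇ-map _ (embedˡ n₂) X₁) (cong (map (embedˡ n₂)) (filterᵇ-cong (λ e → meets-embedˡ n₂ e R₁ R₂) X₁)))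
    (trans (filterᵇ-map _ (embedʳ n₁) X₂) (cong (map (embedʳ n₁)) (filterᵇ-cong (λ e → meets-embedʳ n₁ e R₂ R₁) X₂))))

  step-⊔ᴱ : ∀ R₁ R₂ → step (X₁ ⊔ᴱ X₂) (R₁ ++ R₂) ≡ step X₁ R₁ ++ step X₂ R₂
  step-⊔ᴱ R₁ R₂ = trans (cong (λ F → (R₁ ++ R₂) ∪ᵇ bigUnion F) (filter-meets-⊔ᴱ R₁ R₂))
    (trans (cong ((R₁ ++ R₂) ∪ᵇ_) (bigUnion-⊔ᴱ (filterᵇ (λ e → meets e R₁) X₁) (filterᵇ (λ e → meets e R₂) X₂)))
           (VecP.zipWith-++ _∨_ R₁ R₂ _ _))

  iterate-⊔ᴱ : ∀ k R₁ R₂ → iter k (step (X₁ ⊔ᴱ X₂)) (R₁ ++ R₂) ≡ iter k (step X₁) R₁ ++ iter k (step X₂) R₂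
  iterate-⊔ᴱ zero R₁ R₂ = refl
  iterate-⊔ᴱ (suc k) R₁ R₂ =
    trans (cong (step (X₁ ⊔ᴱ X₂)) (iterate-⊔ᴱ k R₁ R₂)) (step-⊔ᴱ (iter k (step X₁) R₁) (iter k (step X₂) R₂))

  component-↑ˡ : ∀ i → component (X₁ ⊔ᴱ X₂) (i ↑ˡ n₂) ≡ embedˡ n₂ (component X₁ i)
  component-↑ˡ i = trans (cong (iter (n₁ +ℕ n₂) (step (X₁ ⊔ᴱ X₂))) (single-↑ˡ n₂ i))
    (trans (iterate-⊔ᴱ (n₁ +ℕ n₂) (single i) (replicate n₂ false))
      (cong₂ _++_ (trans (cong (λ k → iter k (step X₁) (single i)) (ℕP.+-comm n₁ n₂)) (iterate-beyond-component X₁ i n₂))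
                  (iterate-step-∅ X₂ (n₁ +ℕ n₂))))

  component-↑ʳ : ∀ j → component (X₁ ⊔ᴱ X₂) (n₁ ↑ʳ j) ≡ embedʳ n₁ (component X₂ j)
  component-↑ʳ j = trans (cong (iter (n₁ +ℕ n₂) (step (X₁ ⊔ᴱ X₂))) (single-↑ʳ n₁ j))
    (trans (iterate-⊔ᴱ (n₁ +ℕ n₂) (replicate n₁ false) (single j))
      (cong₂ _++_ (iterate-step-∅ X₁ (n₁ +ℕ n₂)) (iterate-beyond-component X₂ j n₁)))

  isRoot-↑ˡ : ∀ W₁ W₂ i → isRoot (W₁ ++ W₂) (X₁ ⊔ᴱ X₂) (i ↑ˡ n₂) ≡ isRoot W₁ X₁ i
  isRoot-↑ˡ W₁ W₂ i = cong₂ _∧_ (VecP.lookup-++ˡ W₁ W₂ i)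
    (trans (cong (λ C → sameFin (minElem C) (i ↑ˡ n₂)) (component-↑ˡ i))
      (trans (cong (λ m → sameFin m (i ↑ˡ n₂)) (minElem-++ˡ n₂ (component X₁ i)))
        (sameFin-map (_↑ˡ n₂) (FinP.↑ˡ-injective n₂) (minElem (component X₁ i)) i)))

  isRoot-↑ʳ : ∀ W₁ W₂ j → isRoot (W₁ ++ W₂) (X₁ ⊔ᴱ X₂) (n₁ ↑ʳ j) ≡ isRoot W₂ X₂ j
  isRoot-↑ʳ W₁ W₂ j = cong₂ _∧_ (VecP.lookup-++ʳ W₁ W₂ j)
    (trans (cong (λ C → sameFin (minElem C) (n₁ ↑ʳ j)) (component-↑ʳ j))
      (trans (cong (λ m → sameFin m (n₁ ↑ʳ j)) (minElem-++ʳ n₁ (component X₂ j)))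
        (sameFin-map (n₁ ↑ʳ_) (FinP.↑ʳ-injective n₁) (minElem (component X₂ j)) j)))

  kComp-⊔ᴱ : ∀ W₁ W₂ → kComp (W₁ ++ W₂) (X₁ ⊔ᴱ X₂) ≡ kComp W₁ X₁ +ℕ kComp W₂ X₂
  kComp-⊔ᴱ W₁ W₂ = begin
    kComp (W₁ ++ W₂) (X₁ ⊔ᴱ X₂)
      ≡⟨ kComp≡count-isRoot (W₁ ++ W₂) (X₁ ⊔ᴱ X₂) ⟩
    count (isRoot (W₁ ++ W₂) (X₁ ⊔ᴱ X₂))
      ≡⟨ count-splitAt n₁ (isRoot (W₁ ++ W₂) (X₁ ⊔ᴱ X₂)) ⟩
    count (λ i → isRoot (W₁ ++ W₂) (X₁ ⊔ᴱ X₂) (i ↑ˡ n₂)) +ℕ count (λ j → isRoot (W₁ ++ W₂) (X₁ ⊔ᴱ X₂) (n₁ ↑ʳ j))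
      ≡⟨ cong₂ _+ℕ_ (count-cong (isRoot-↑ˡ W₁ W₂)) (count-cong (isRoot-↑ʳ W₁ W₂)) ⟩
    count (isRoot W₁ X₁) +ℕ count (isRoot W₂ X₂)
      ≡⟨ sym (cong₂ _+ℕ_ (kComp≡count-isRoot W₁ X₁) (kComp≡count-isRoot W₂ X₂)) ⟩
    kComp W₁ X₁ +ℕ kComp W₂ X₂ ∎
    where open ≡-Reasoning

-- Contracting an edge

contractEdge : ∀ {n} → Subset n → Subset n → Subset (suc n)
contractEdge e f = if meets f e then true ∷ (f ∖ᵇ e) else false ∷ f

collapse : ∀ {n} → Subset n → Fin n → Fin (suc n)
collapse e a = if lookup e a then zero else suc a

module _ {n} (e : Subset n) where

  collapse-member : ∀ {a} → lookup e a ≡ true → collapse e a ≡ zero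
  collapse-member ea rewrite ea = refl

  collapse-nonmember : ∀ {a} → lookup e a ≡ false → collapse e a ≡ suc a
  collapse-nonmember ea rewrite ea = refl

  collapse≡zero⁻ : ∀ a → collapse e a ≡ zero → lookup e a ≡ true
  collapse≡zero⁻ a h with lookup e a
  ... | true = refl

  collapse≡suc⁻ : ∀ a {w} → collapse e a ≡ suc w → lookup e a ≡ false × a ≡ w
  collapse≡suc⁻ a h with lookup e a
  ... | false = refl , FinP.suc-injective h

  lookup-contractEdge-collapse : ∀ g a → lookup g a ≡ true → lookup (contractEdge e g) (collapse e a) ≡ true
  lookup-contractEdge-collapse g a ga with lookup e a in ea
  ... | true rewrite meets-true⁺ g e a ga ea = refl
  ... | false with meets g e
  ...   | true = lookup-∖-true⁺ g e a ga ea
  ...   | false = ga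

  lookup-contractEdge-zero⁺ : ∀ g → meets g e ≡ true → lookup (contractEdge e g) zero ≡ true
  lookup-contractEdge-zero⁺ g h rewrite h = refl

  lookup-contractEdge-zero⁻ : ∀ g → lookup (contractEdge e g) zero ≡ true → meets g e ≡ true
  lookup-contractEdge-zero⁻ g h with meets g e
  ... | true = refl
  ... | false = h

  lookup-contractEdge-suc⁻ : ∀ g w → lookup (contractEdge e g) (suc w) ≡ true → lookup g w ≡ true × lookup e w ≡ false
  lookup-contractEdge-suc⁻ g w h with meets g e in ge
  ... | true = lookup-∖-true⁻ g e w h
  ... | false = h , meets-false⁻ g e w ge h

  lookup-contractEdge-suc : ∀ g u → lookup e u ≡ false → lookup (contractEdge e g) (suc u) ≡ lookup g u
  lookup-contractEdge-suc g u eu with meets g e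
  ... | true = lookup-∖-nonmember g e u eu
  ... | false = refl

  contractEdge-preimage : ∀ g w → lookup (contractEdge e g) w ≡ true → ∃ λ b → collapse e b ≡ w × lookup g b ≡ true
  contractEdge-preimage g zero h with meets-true⁻ g e (lookup-contractEdge-zero⁻ g h)
  ... | b , gb , eb = b , collapse-member eb , gb
  contractEdge-preimage g (suc w) h with lookup-contractEdge-suc⁻ g w h
  ... | gw , ew = w , collapse-nonmember ew , gw

  covers-contractEdge-suc : ∀ (L : List (Subset n)) u → lookup e u ≡ false →
    covers (map (contractEdge e) L) (suc u) ≡ covers L u
  covers-contractEdge-suc [] u eu = refl
  covers-contractEdge-suc (g ∷ L) u eu = cong₂ _∨_ (lookup-contractEdge-suc g u eu) (covers-contractEdge-suc L u eu)

-- Contraction of the first edge e of e ∷ L merges the component of e into the new vertex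
-- and leaves every other component unchanged, so the component count is preserved.
module Contraction {n} (W e : Subset n) (L : List (Subset n)) (v₀ : Fin n) (ev₀ : lookup e v₀ ≡ true)
                   (e⊆W : e ⊆ᵇ W) (L⊆W : ∀ {g} → g ∈ L → g ⊆ᵇ W) where

  W' : Subset (suc n)
  W' = true ∷ (W ∖ᵇ e)

  L' : List (Subset (suc n))
  L' = map (contractEdge e) L

  Connected-collapse : ∀ {a b} → Connected (e ∷ L) a b → Connected L' (collapse e a) (collapse e b)
  Connected-collapse ε = ε
  Connected-collapse (hop .e (here refl) ea ew p) rewrite collapse-member e ea =
    subst (λ x → Connected L' x _) (collapse-member e ew) (Connected-collapse p)
  Connected-collapse {a} (hop {w = w} g (there g∈) ga gw p) =
    hop (contractEdge e g) (∈-map⁺ (contractEdge e) g∈)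
        (lookup-contractEdge-collapse e g a ga) (lookup-contractEdge-collapse e g w gw) (Connected-collapse p)

  private
    enter : ∀ g a → lookup (contractEdge e g) (collapse e a) ≡ true → ∃ λ m → lookup g m ≡ true × Connected (e ∷ L) a m
    enter g a h with lookup e a in ea
    ... | true with meets-true⁻ g e (lookup-contractEdge-zero⁻ e g h)
    ...   | m , gm , em = m , gm , Connected-edge e (here refl) ea em
    enter g a h | false = a , proj₁ (lookup-contractEdge-suc⁻ e g a h) , ε

  Connected-lift : ∀ {x y} → Connected L' x y → ∀ a → collapse e a ≡ x → ∃ λ b → collapse e b ≡ y × Connected (e ∷ L) a b
  Connected-lift ε a ax = a , ax , ε
  Connected-lift (hop g' g'∈ gx gw p) a ax with ∈-map⁻ (contractEdge e) g'∈
  ... | g , g∈ , refl with contractEdge-preimage e g _ gw | enter g a (subst (λ x → lookup (contractEdge e g) x ≡ true) (sym ax) gx)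
  ...   | b , bw , gb | m , gm , a~m with Connected-lift p b bw
  ...     | c , cy , b~c = c , cy , Connected-trans a~m (hop g (there g∈) gm gb b~c)

  inC₀ : Fin n → Bool
  inC₀ = lookup (component (e ∷ L) v₀)

  C₀-has-one-root : count (λ u → isRoot W (e ∷ L) u ∧ inC₀ u) ≡ 1
  C₀-has-one-root = count-unique _ r₀ r₀-isRoot unique
    where
    Es = e ∷ L
    Es⊆W : ∀ {g} → g ∈ Es → g ⊆ᵇ W
    Es⊆W (here refl) = e⊆W
    Es⊆W (there g∈) = L⊆W g∈
    minC₀ : ∃ λ r → minElem (component Es v₀) ≡ just r
    minC₀ = minElem-nonempty (component Es v₀) v₀ (component-self Es v₀)
    r₀ = proj₁ minC₀
    C₀r₀ : inC₀ r₀ ≡ true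
    C₀r₀ = minElem-member (component Es v₀) r₀ (proj₂ minC₀)
    r₀-isRoot : (isRoot W Es r₀ ∧ inC₀ r₀) ≡ true
    r₀-isRoot = ∧-true⁺ (∧-true⁺
      (Connected-preserves W Es⊆W (e⊆W v₀ ev₀) (component-sound Es v₀ r₀ C₀r₀))
      (subst (λ m → sameFin m r₀ ≡ true)
        (sym (trans (cong minElem (sym (Connected⇒component-≡ Es v₀ r₀ (component-sound Es v₀ r₀ C₀r₀)))) (proj₂ minC₀)))
        (sameFin-self r₀)))
      C₀r₀
    unique : ∀ u → (isRoot W Es u ∧ inC₀ u) ≡ true → u ≡ r₀
    unique u h with ∧-true⁻ h
    ... | isRoot-u , C₀u with ∧-true⁻ {lookup W u} isRoot-u
    ...   | _ , u-min with trans (sym (sameFin-true⁻ _ u u-min))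
                         (trans (cong minElem (sym (Connected⇒component-≡ Es v₀ u (component-sound Es v₀ u C₀u))))
                                (proj₂ minC₀))
    ...     | refl = refl

  isRoot-contract-zero : isRoot W' L' zero ≡ true
  isRoot-contract-zero rewrite minElem-zero (component L' zero) (component-self L' zero) = refl

  module Outside (u : Fin n) (C₀u : inC₀ u ≡ false) where

    avoids-e : ∀ w → Connected (e ∷ L) u w → lookup e w ≡ false
    avoids-e w u~w = BoolP.¬-not λ ew → true≢false (trans (sym (component-complete (e ∷ L) v₀ u
      (Connected-trans (Connected-edge e (here refl) ev₀ ew) (Connected-sym u~w)))) C₀u)

    eu : lookup e u ≡ false
    eu = avoids-e u ε

    component-contract : component L' (suc u) ≡ false ∷ component (e ∷ L) u
    component-contract = lookup-ext _ _ λ where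
      zero → BoolP.¬-not λ h → let (b , b↦0 , u~b) = Connected-lift (component-sound L' (suc u) zero h) u (collapse-nonmember e eu)
                                in true≢false (trans (sym (collapse≡zero⁻ e b b↦0)) (avoids-e b u~b))
      (suc w) → bool-ext
        (λ h → let (b , b↦w , u~b) = Connected-lift (component-sound L' (suc u) (suc w) h) u (collapse-nonmember e eu)
               in component-complete (e ∷ L) u w (subst (Connected (e ∷ L) u) (proj₂ (collapse≡suc⁻ e b b↦w)) u~b))
        (λ h → let u~w = component-sound (e ∷ L) u w h in
               component-complete L' (suc u) (suc w)
                 (subst₂ (Connected L') (collapse-nonmember e eu) (collapse-nonmember e (avoids-e w u~w)) (Connected-collapse u~w)))

  isRoot-contract-suc : ∀ u → isRoot W' L' (suc u) ≡ (isRoot W (e ∷ L) u ∧ not (inC₀ u))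
  isRoot-contract-suc u with inC₀ u in C₀u
  ... | false = trans (cong₂ _∧_ (lookup-∖-nonmember W e u eu)
                 (trans (cong (λ C → sameFin (minElem C) (suc u)) component-contract)
                   (sameFin-map suc (λ _ _ → FinP.suc-injective) (minElem (component (e ∷ L) u)) u)))
                (sym (BoolP.∧-identityʳ _))
    where open Outside u C₀u
  ... | true with lookup e u in eu
  ...   | true = trans (cong (_∧ _) (lookup-∖-member W e u eu)) (sym (BoolP.∧-zeroʳ _))
  -- The component of suc u contains the new vertex zero, so suc u is not its least element.
  ...   | false = trans (cong (λ m → lookup (W ∖ᵇ e) u ∧ sameFin m (suc u))
                    (minElem-zero (component L' (suc u)) (component-complete L' (suc u) zero
                      (subst₂ (Connected L') (collapse-nonmember e eu) (collapse-member e ev₀)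
                        (Connected-collapse (Connected-sym (component-sound (e ∷ L) v₀ u C₀u)))))))
                  (trans (BoolP.∧-zeroʳ _) (sym (BoolP.∧-zeroʳ _)))

  kComp-contract : kComp W (e ∷ L) ≡ kComp W' L'
  kComp-contract = begin
    kComp W (e ∷ L)
      ≡⟨ kComp≡count-isRoot W (e ∷ L) ⟩
    count (isRoot W (e ∷ L))
      ≡⟨ count-partition (isRoot W (e ∷ L)) inC₀ ⟩
    count (λ u → isRoot W (e ∷ L) u ∧ inC₀ u) +ℕ count (λ u → isRoot W (e ∷ L) u ∧ not (inC₀ u))
      ≡⟨ cong₂ _+ℕ_ (trans C₀-has-one-root (cong boolToℕ (sym isRoot-contract-zero)))
                    (sym (count-cong isRoot-contract-suc)) ⟩
    count (isRoot W' L')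
      ≡⟨ sym (kComp≡count-isRoot W' L') ⟩
    kComp W' L' ∎
    where open ≡-Reasoning

-- Bounds on the number of components

Nonemptyᵇ : ∀ {n} → Subset n → Set
Nonemptyᵇ g = ∃ λ v → lookup g v ≡ true

IsEdgeOf : ∀ {n} → Subset n → Subset n → Set
IsEdgeOf W g = g ⊆ᵇ W × Nonemptyᵇ g

contractEdge-isEdgeOf : ∀ {n} {W e g : Subset n} → IsEdgeOf W g → IsEdgeOf (true ∷ (W ∖ᵇ e)) (contractEdge e g)
contractEdge-isEdgeOf {W = W} {e} {g} (g⊆W , v , gv) = g'⊆W' , collapse e v , lookup-contractEdge-collapse e g v gv
  where
  g'⊆W' : contractEdge e g ⊆ᵇ (true ∷ (W ∖ᵇ e))
  g'⊆W' zero _ = refl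
  g'⊆W' (suc w) h with lookup-contractEdge-suc⁻ e g w h
  ... | gw , ew = lookup-∖-true⁺ W e w (g⊆W w gw) ew

private
  kComp≤length+uncovered′ : ∀ k {n} (W : Subset n) (Es : List (Subset n)) → length Es ≡ k → All (IsEdgeOf W) Es →
    kComp W Es ≤ length Es +ℕ count (λ u → lookup W u ∧ not (covers Es u))
  kComp≤length+uncovered′ _ W [] _ _ = ℕP.≤-trans (ℕP.≤-reflexive (kComp≡count-isRoot W []))
    (count-mono _ _ λ u h → trans (BoolP.∧-identityʳ _) (proj₁ (∧-true⁻ {lookup W u} h)))
  kComp≤length+uncovered′ (suc k) W (e ∷ L) |e∷L| ((e⊆W , v₀ , ev₀) ∷ L-edges) = begin
    kComp W (e ∷ L)
      ≡⟨ kComp-contract ⟩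
    kComp W' L'
      ≤⟨ kComp≤length+uncovered′ k W' L' (trans (ListP.length-map (contractEdge e) L) (ℕP.suc-injective |e∷L|))
           (AllP.map⁺ (All.map (λ {g} → contractEdge-isEdgeOf {W = W} {e} {g}) L-edges)) ⟩
    length L' +ℕ (boolToℕ _ +ℕ count (λ u → lookup W' (suc u) ∧ not (covers L' (suc u))))
      ≤⟨ ℕP.+-monoʳ-≤ (length L') (ℕP.+-mono-≤ (boolToℕ≤1 _) (count-mono _ _ uncovered-suc)) ⟩
    length L' +ℕ suc (count (λ u → lookup W u ∧ not (covers (e ∷ L) u)))
      ≡⟨ trans (ℕP.+-suc (length L') uncovered) (cong (λ l → suc (l +ℕ uncovered)) (ListP.length-map (contractEdge e) L)) ⟩
    length (e ∷ L) +ℕ count (λ u → lookup W u ∧ not (covers (e ∷ L) u)) ∎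
    where
    open ℕP.≤-Reasoning
    open Contraction W e L v₀ ev₀ e⊆W (λ g∈ → proj₁ (All.lookup L-edges g∈))
    uncovered = count (λ u → lookup W u ∧ not (covers (e ∷ L) u))
    uncovered-suc : ∀ u → (lookup W' (suc u) ∧ not (covers L' (suc u))) ≡ true →
      (lookup W u ∧ not (covers (e ∷ L) u)) ≡ true
    uncovered-suc u h with lookup e u in eu | ∧-true⁻ {lookup W' (suc u)} h
    ... | true | W'u , _ = ⊥-elim (true≢false (trans (sym W'u) (lookup-∖-member W e u eu)))
    ... | false | W'u , L'u = ∧-true⁺ (proj₁ (lookup-∖-true⁻ W e u W'u)) (trans (cong not (sym (covers-contractEdge-suc e L u eu))) L'u)

kComp≤length+uncovered : ∀ {n} (W : Subset n) (Es : List (Subset n)) → All (IsEdgeOf W) Es →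
  kComp W Es ≤ length Es +ℕ count (λ u → lookup W u ∧ not (covers Es u))
kComp≤length+uncovered W Es = kComp≤length+uncovered′ (length Es) W Es refl

kComp-bigUnion≤length : ∀ {n} (B : List (Subset n)) → All Nonemptyᵇ B → kComp (bigUnion B) B ≤ length B
kComp-bigUnion≤length B B-nonempty = begin
  kComp (bigUnion B) B
    ≤⟨ kComp≤length+uncovered (bigUnion B) B (All.tabulate (λ g∈ → ∈⇒⊆bigUnion g∈ , All.lookup B-nonempty g∈)) ⟩
  length B +ℕ count (λ u → lookup (bigUnion B) u ∧ not (covers B u))
    ≡⟨ cong (length B +ℕ_) (count-none _ λ u →
         trans (cong (_∧ not (covers B u)) (lookup-bigUnion B u)) (BoolP.∧-inverseʳ (covers B u))) ⟩
  length B +ℕ 0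
    ≡⟨ ℕP.+-identityʳ (length B) ⟩
  length B ∎
  where open ℕP.≤-Reasoning

vertexDisjoint-true⁻ : ∀ {n} (A B : List (Subset n)) → vertexDisjoint A B ≡ true →
  ∀ {a b} → a ∈ A → b ∈ B → meets a b ≡ false
vertexDisjoint-true⁻ A B h a∈ b∈ = not-true⁻ (allᵇ-true⁻ _ B (allᵇ-true⁻ _ A h a∈) b∈)

vertexDisjoint-↭ : ∀ {n} {A A' B B' : List (Subset n)} → A ↭ A' → B ↭ B' → vertexDisjoint A B ≡ vertexDisjoint A' B'
vertexDisjoint-↭ {A = A} pA pB = trans (allᵇ-cong (λ a → allᵇ-↭ _ pB) A) (allᵇ-↭ _ pA)

-- Vertex disjointness makes every component of (⋃ B, B) a component of (W, A ++ B).
kComp-bigUnion≤kComp : ∀ {n} (W : Subset n) (A B : List (Subset n)) → All (λ g → g ⊆ᵇ W) B →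
  vertexDisjoint A B ≡ true → kComp (bigUnion B) B ≤ kComp W (A List.++ B)
kComp-bigUnion≤kComp W A B B⊆W disjoint = begin
  kComp (bigUnion B) B         ≡⟨ kComp≡count-isRoot (bigUnion B) B ⟩
  count (isRoot (bigUnion B) B) ≤⟨ count-mono _ _ isRoot-mono ⟩
  count (isRoot W (A List.++ B)) ≡⟨ sym (kComp≡count-isRoot W (A List.++ B)) ⟩
  kComp W (A List.++ B)        ∎
  where
  open ℕP.≤-Reasoning
  stays-in-B : ∀ {v u} → lookup (bigUnion B) v ≡ true → Connected (A List.++ B) v u → Connected B v u
  stays-in-B Bv ε = ε
  stays-in-B {v} Bv (hop g g∈ gv gw p) with ∈-++⁻ A g∈ | covers-true⁻ B v (trans (sym (lookup-bigUnion B v)) Bv)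
  ... | inj₁ g∈A | b , b∈B , bv =
    ⊥-elim (true≢false (trans (sym (meets-true⁺ g b v gv bv)) (vertexDisjoint-true⁻ A B disjoint g∈A b∈B)))
  ... | inj₂ g∈B | _ = hop g g∈B gv gw (stays-in-B (∈⇒⊆bigUnion g∈B _ gw) p)
  isRoot-mono : ∀ v → isRoot (bigUnion B) B v ≡ true → isRoot W (A List.++ B) v ≡ true
  isRoot-mono v h with ∧-true⁻ {lookup (bigUnion B) v} h
  ... | Bv , v-min with covers-true⁻ B v (trans (sym (lookup-bigUnion B v)) Bv)
  ...   | b , b∈B , bv = ∧-true⁺ (All.lookup B⊆W b∈B v bv)
    (trans (cong (λ C → sameFin (minElem C) v)
      (component-ext (A List.++ B) B v v (λ u → stays-in-B Bv) (λ u → Connected-mono (∈-++⁺ʳ A)))) v-min)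

meets-embedˡ-embedˡ : ∀ {n₁} n₂ (a b : Subset n₁) → meets (embedˡ n₂ a) (embedˡ n₂ b) ≡ meets a b
meets-embedˡ-embedˡ n₂ a b = meets-embedˡ n₂ a b (replicate n₂ false)

meets-embedʳ-embedʳ : ∀ n₁ {n₂} (a b : Subset n₂) → meets (embedʳ n₁ a) (embedʳ n₁ b) ≡ meets a b
meets-embedʳ-embedʳ n₁ a b = meets-embedʳ n₁ a b (replicate n₁ false)

meets-embedˡ-embedʳ : ∀ {n₁ n₂} (a : Subset n₁) (b : Subset n₂) → meets (embedˡ n₂ a) (embedʳ n₁ b) ≡ false
meets-embedˡ-embedʳ {n₁} {n₂} a b = trans (meets-embedˡ n₂ a (replicate n₁ false) b) (meets-∅ a)

meets-embedʳ-embedˡ : ∀ {n₁ n₂} (a : Subset n₂) (b : Subset n₁) → meets (embedʳ n₁ a) (embedˡ n₂ b) ≡ false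
meets-embedʳ-embedˡ {n₁} {n₂} a b = trans (meets-comm (embedʳ n₁ a) (embedˡ n₂ b)) (meets-embedˡ-embedʳ b a)

vertexDisjoint-⊔ᴱ : ∀ {n₁ n₂} (A₁ B₁ : List (Subset n₁)) (A₂ B₂ : List (Subset n₂)) →
  vertexDisjoint (A₁ ⊔ᴱ A₂) (B₁ ⊔ᴱ B₂) ≡ (vertexDisjoint A₁ B₁ ∧ vertexDisjoint A₂ B₂)
vertexDisjoint-⊔ᴱ {n₁} {n₂} A₁ B₁ A₂ B₂ = trans (allᵇ-++ _ (map (embedˡ n₂) A₁) _) (cong₂ _∧_
  (trans (allᵇ-map _ (embedˡ n₂) A₁) (trans (allᵇ-cong left A₁) (allᵇ-cong (λ a → BoolP.∧-identityʳ _) A₁)))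
  (trans (allᵇ-map _ (embedʳ n₁) A₂) (allᵇ-cong right A₂)))
  where
  left : ∀ a → allᵇ (λ b → not (meets (embedˡ n₂ a) b)) (B₁ ⊔ᴱ B₂) ≡ (allᵇ (λ b → not (meets a b)) B₁ ∧ true)
  left a = trans (allᵇ-++ _ (map (embedˡ n₂) B₁) _) (cong₂ _∧_
    (trans (allᵇ-map _ (embedˡ n₂) B₁) (allᵇ-cong (λ b → cong not (meets-embedˡ-embedˡ n₂ a b)) B₁))
    (trans (allᵇ-map _ (embedʳ n₁) B₂) (trans (allᵇ-cong (λ b → cong not (meets-embedˡ-embedʳ a b)) B₂) (allᵇ-const-true B₂))))
  right : ∀ a → allᵇ (λ b → not (meets (embedʳ n₁ a) b)) (B₁ ⊔ᴱ B₂) ≡ allᵇ (λ b → not (meets a b)) B₂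
  right a = trans (allᵇ-++ _ (map (embedˡ n₂) B₁) _) (cong₂ _∧_
    (trans (allᵇ-map _ (embedˡ n₂) B₁) (trans (allᵇ-cong (λ b → cong not (meets-embedʳ-embedˡ a b)) B₁) (allᵇ-const-true B₁)))
    (trans (allᵇ-map _ (embedʳ n₁) B₂) (allᵇ-cong (λ b → cong not (meets-embedʳ-embedʳ n₁ a b)) B₂)))

++-interchange-⊆ : ∀ {A : Set} (a b c d : List A) → (a List.++ b) List.++ (c List.++ d) ⊆ˡ (a List.++ c) List.++ (b List.++ d)
++-interchange-⊆ a b c d x∈ with ∈-++⁻ (a List.++ b) x∈
... | inj₁ x∈ab with ∈-++⁻ a x∈ab
...   | inj₁ x∈a = ∈-++⁺ˡ (∈-++⁺ˡ x∈a)
...   | inj₂ x∈b = ∈-++⁺ʳ (a List.++ c) (∈-++⁺ˡ x∈b)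
++-interchange-⊆ a b c d x∈ | inj₂ x∈cd with ∈-++⁻ c x∈cd
...   | inj₁ x∈c = ∈-++⁺ˡ (∈-++⁺ʳ a x∈c)
...   | inj₂ x∈d = ∈-++⁺ʳ (a List.++ c) (∈-++⁺ʳ b x∈d)

kComp-⊔ᴱ-pair : ∀ {n₁ n₂} (V₁ : Subset n₁) (V₂ : Subset n₂) (A₁ B₁ : List (Subset n₁)) (A₂ B₂ : List (Subset n₂)) →
  kComp (V₁ ++ V₂) ((A₁ ⊔ᴱ A₂) List.++ (B₁ ⊔ᴱ B₂)) ≡ kComp V₁ (A₁ List.++ B₁) +ℕ kComp V₂ (A₂ List.++ B₂)
kComp-⊔ᴱ-pair {n₁} {n₂} V₁ V₂ A₁ B₁ A₂ B₂ = begin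
  kComp (V₁ ++ V₂) ((A₁ ⊔ᴱ A₂) List.++ (B₁ ⊔ᴱ B₂))
    ≡⟨ kComp-resp-⊆ˡ (V₁ ++ V₂) (++-interchange-⊆ A₁' A₂' B₁' B₂') (++-interchange-⊆ A₁' B₁' A₂' B₂') ⟩
  kComp (V₁ ++ V₂) ((A₁' List.++ B₁') List.++ (A₂' List.++ B₂'))
    ≡⟨ sym (cong₂ (λ X Y → kComp (V₁ ++ V₂) (X List.++ Y)) (ListP.map-++ (embedˡ n₂) A₁ B₁) (ListP.map-++ (embedʳ n₁) A₂ B₂)) ⟩
  kComp (V₁ ++ V₂) ((A₁ List.++ B₁) ⊔ᴱ (A₂ List.++ B₂))
    ≡⟨ DisjointUnion.kComp-⊔ᴱ (A₁ List.++ B₁) (A₂ List.++ B₂) V₁ V₂ ⟩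
  kComp V₁ (A₁ List.++ B₁) +ℕ kComp V₂ (A₂ List.++ B₂) ∎
  where
  open ≡-Reasoning
  A₁' = map (embedˡ n₂) A₁
  B₁' = map (embedˡ n₂) B₁
  A₂' = map (embedʳ n₁) A₂
  B₂' = map (embedʳ n₁) B₂

length-⊔ᴱ-pair : ∀ {n₁ n₂} (A₁ B₁ : List (Subset n₁)) (A₂ B₂ : List (Subset n₂)) →
  length ((A₁ ⊔ᴱ A₂) List.++ (B₁ ⊔ᴱ B₂)) ≡ length (A₁ List.++ B₁) +ℕ length (A₂ List.++ B₂)
length-⊔ᴱ-pair {n₁} {n₂} A₁ B₁ A₂ B₂ = begin
  length ((A₁ ⊔ᴱ A₂) List.++ (B₁ ⊔ᴱ B₂))
    ≡⟨ ListP.length-++ (A₁ ⊔ᴱ A₂) ⟩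
  length (A₁ ⊔ᴱ A₂) +ℕ length (B₁ ⊔ᴱ B₂)
    ≡⟨ cong₂ _+ℕ_ (length-⊔ᴱ A₁ A₂) (length-⊔ᴱ B₁ B₂) ⟩
  (length A₁ +ℕ length A₂) +ℕ (length B₁ +ℕ length B₂)
    ≡⟨ CommSemigroupProps.interchange ℕP.+-commutativeSemigroup (length A₁) (length A₂) (length B₁) (length B₂) ⟩
  (length A₁ +ℕ length B₁) +ℕ (length A₂ +ℕ length B₂)
    ≡⟨ sym (cong₂ _+ℕ_ (ListP.length-++ A₁) (ListP.length-++ A₂)) ⟩
  length (A₁ List.++ B₁) +ℕ length (A₂ List.++ B₂) ∎
  where
  open ≡-Reasoning
  length-⊔ᴱ : ∀ X₁ X₂ → length (X₁ ⊔ᴱ X₂) ≡ length X₁ +ℕ length X₂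
  length-⊔ᴱ X₁ X₂ = trans (ListP.length-++ (map (embedˡ n₂) X₁)) (cong₂ _+ℕ_ (ListP.length-map _ X₁) (ListP.length-map _ X₂))

kComp-bigUnion-⊔ᴱ : ∀ {n₁ n₂} (B₁ : List (Subset n₁)) (B₂ : List (Subset n₂)) →
  kComp (bigUnion (B₁ ⊔ᴱ B₂)) (B₁ ⊔ᴱ B₂) ≡ kComp (bigUnion B₁) B₁ +ℕ kComp (bigUnion B₂) B₂
kComp-bigUnion-⊔ᴱ B₁ B₂ =
  trans (cong (λ W → kComp W (B₁ ⊔ᴱ B₂)) (bigUnion-⊔ᴱ B₁ B₂)) (DisjointUnion.kComp-⊔ᴱ B₁ B₂ (bigUnion B₁) (bigUnion B₂))

kComp-freshVertex : ∀ {n} b (V : Subset n) (X : List (Subset n)) → kComp (b ∷ V) (map (false ∷_) X) ≡ boolToℕ b +ℕ kComp V X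
kComp-freshVertex true V X = DisjointUnion.kComp-⊔ᴱ [] X (true ∷ []) V
kComp-freshVertex false V X = DisjointUnion.kComp-⊔ᴱ [] X (false ∷ []) V

avoids : ∀ {n} → Subset n → List (Subset n) → Bool
avoids e L = allᵇ (λ f → not (meets f e)) L

module _ {n} (e : Subset n) where

  vertexDisjoint-∷ˡ : ∀ A B → vertexDisjoint (e ∷ A) B ≡ (avoids e B ∧ vertexDisjoint A B)
  vertexDisjoint-∷ˡ A B = cong (_∧ vertexDisjoint A B) (allᵇ-cong (λ b → cong not (meets-comm e b)) B)

  vertexDisjoint-∷ʳ : ∀ A B → vertexDisjoint A (e ∷ B) ≡ (avoids e A ∧ vertexDisjoint A B)
  vertexDisjoint-∷ʳ A B = allᵇ-∧ (λ a → not (meets a e)) (λ a → allᵇ (λ b → not (meets a b)) B) A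

  meets-∖-avoiding : ∀ a b → meets a e ≡ false → meets a (b ∖ᵇ e) ≡ meets a b
  meets-∖-avoiding a b ae = bool-ext
    (λ h → let (u , au , bu) = meets-true⁻ a (b ∖ᵇ e) h in meets-true⁺ a b u au (proj₁ (lookup-∖-true⁻ b e u bu)))
    (λ h → let (u , au , bu) = meets-true⁻ a b h in meets-true⁺ a (b ∖ᵇ e) u au (lookup-∖-true⁺ b e u bu (meets-false⁻ a e u ae au)))

  -- Two contracted edges meet iff they met before, or both met e (they now share the new vertex).
  not-meets-contractEdge : ∀ a b →
    not (meets (contractEdge e a) (contractEdge e b)) ≡ ((not (meets a e) ∨ not (meets b e)) ∧ not (meets a b))
  not-meets-contractEdge a b with meets a e in ae | meets b e in be
  ... | true | true = refl
  ... | true | false = cong not (trans (meets-comm (a ∖ᵇ e) b) (trans (meets-∖-avoiding b a be) (meets-comm b a)))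
  ... | false | true = cong not (meets-∖-avoiding a b ae)
  ... | false | false = refl

  vertexDisjoint-contractEdge : ∀ A B →
    vertexDisjoint (map (contractEdge e) A) (map (contractEdge e) B) ≡ ((avoids e A ∨ avoids e B) ∧ vertexDisjoint A B)
  vertexDisjoint-contractEdge A B =
    trans (allᵇ-map _ (contractEdge e) A)
    (trans (allᵇ-cong (λ a → trans (allᵇ-map _ (contractEdge e) B) (trans (allᵇ-cong (not-meets-contractEdge a) B)
                   (trans (allᵇ-∧ _ _ B) (cong (_∧ _) (allᵇ-∨ˡ (not (meets a e)) _ B))))) A)
    (trans (allᵇ-∧ (λ a → not (meets a e) ∨ avoids e B) (λ a → allᵇ (λ b → not (meets a b)) B) A)
      (cong (_∧ vertexDisjoint A B) (allᵇ-∨ʳ (λ a → not (meets a e)) (avoids e B) A))))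

  contractEdge-avoiding : ∀ L → avoids e L ≡ true → map (contractEdge e) L ≡ map (false ∷_) L
  contractEdge-avoiding [] h = refl
  contractEdge-avoiding (g ∷ L) h with meets g e
  ... | false = cong ((false ∷ g) ∷_) (contractEdge-avoiding L h)

  covers-contractEdge-member : ∀ L u → lookup e u ≡ true → covers (map (contractEdge e) L) (suc u) ≡ false
  covers-contractEdge-member L u eu = BoolP.¬-not λ h →
    let (g' , g'∈ , g'u) = covers-true⁻ (map (contractEdge e) L) (suc u) h
        (g , _ , g'≡) = ∈-map⁻ (contractEdge e) g'∈
    in true≢false (trans (sym eu) (proj₂ (lookup-contractEdge-suc⁻ e g u (subst (λ x → lookup x (suc u) ≡ true) g'≡ g'u))))

  kComp-bigUnion-contractEdge-avoiding : ∀ B → avoids e B ≡ true →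
    kComp (bigUnion (map (contractEdge e) B)) (map (contractEdge e) B) ≡ kComp (bigUnion B) B
  kComp-bigUnion-contractEdge-avoiding B h
    rewrite contractEdge-avoiding B h | bigUnion-embedʳ 1 B = kComp-freshVertex false (bigUnion B) B

  -- Contracting e turns H × (e ∷ B) into H × B with B contracted; the new vertex stays covered
  -- because some edge of B meets e.
  kComp-bigUnion-∷-meeting : (v₀ : Fin n) → lookup e v₀ ≡ true → ∀ B → avoids e B ≡ false →
    kComp (bigUnion (e ∷ B)) (e ∷ B) ≡ kComp (bigUnion (map (contractEdge e) B)) (map (contractEdge e) B)
  kComp-bigUnion-∷-meeting v₀ ev₀ B h = trans kComp-contract (cong (λ V → kComp V (map (contractEdge e) B)) W'≡)
    where
    U = bigUnion (e ∷ B)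
    open Contraction U e B v₀ ev₀ (∈⇒⊆bigUnion {L = e ∷ B} (here refl)) (λ g∈ → ∈⇒⊆bigUnion {L = e ∷ B} (there g∈))
    covers-suc : ∀ u → covers (map (contractEdge e) B) (suc u) ≡ ((lookup e u ∨ covers B u) ∧ not (lookup e u))
    covers-suc u with lookup e u in eu
    ... | true = covers-contractEdge-member B u eu
    ... | false = trans (covers-contractEdge-suc e B u eu) (sym (BoolP.∧-identityʳ _))
    W'≡ : (true ∷ (U ∖ᵇ e)) ≡ bigUnion (map (contractEdge e) B)
    W'≡ = lookup-ext _ _ λ where
      zero → let (b , b∈B , b-meets) = allᵇ-false⁻ _ B h in
        sym (trans (lookup-bigUnion (map (contractEdge e) B) zero)
          (covers-true⁺ (map (contractEdge e) B) zero (∈-map⁺ (contractEdge e) b∈B)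
            (lookup-contractEdge-zero⁺ e b (BoolP.not-injective b-meets))))
      (suc u) → trans (lookup-∖ U e u) (trans (cong (_∧ not (lookup e u)) (lookup-bigUnion (e ∷ B) u))
                  (sym (trans (lookup-bigUnion (map (contractEdge e) B) (suc u)) (covers-suc u))))

  kComp-bigUnion-∷-avoiding : (v₀ : Fin n) → lookup e v₀ ≡ true → ∀ B → avoids e B ≡ true →
    kComp (bigUnion (e ∷ B)) (e ∷ B) ≡ suc (kComp (bigUnion B) B)
  kComp-bigUnion-∷-avoiding v₀ ev₀ B h =
    trans kComp-contract (trans (cong₂ (λ V L → kComp (true ∷ V) L) U∖e≡ (contractEdge-avoiding B h))
                                (kComp-freshVertex true (bigUnion B) B))
    where
    U = bigUnion (e ∷ B)
    open Contraction U e B v₀ ev₀ (∈⇒⊆bigUnion {L = e ∷ B} (here refl)) (λ g∈ → ∈⇒⊆bigUnion {L = e ∷ B} (there g∈))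
    U∖e≡ : (U ∖ᵇ e) ≡ bigUnion B
    U∖e≡ = lookup-ext _ _ λ u → trans (lookup-∖ U e u) (trans (cong (_∧ not (lookup e u)) (lookup-bigUnion (e ∷ B) u))
             (sym (trans (lookup-bigUnion B u) (covers-B u))))
      where
      covers-B : ∀ u → covers B u ≡ ((lookup e u ∨ covers B u) ∧ not (lookup e u))
      covers-B u with lookup e u in eu
      ... | true = BoolP.¬-not λ Bu → let (b , b∈B , bu) = covers-true⁻ B u Bu in
                   true≢false (trans (sym (meets-true⁺ b e u bu eu)) (not-true⁻ (allᵇ-true⁻ _ B h b∈B)))
      ... | false = sym (BoolP.∧-identityʳ _)

-- Sums over pairs of edge lists

module PairSums {c ℓ} (R : CommutativeSemiring c ℓ) where
  open CommutativeSemiring R hiding (zero) renaming (refl to ≈-refl; sym to ≈-sym; trans to ≈-trans)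
  open import Relation.Binary.Reasoning.Setoid setoid

  ∑ : ∀ {A : Set} → (A → Carrier) → List A → Carrier
  ∑ F = List.foldr (λ p r → F p + r) 0#

  ∑-cong : ∀ {A : Set} {F G : A → Carrier} → (∀ p → F p ≈ G p) → ∀ L → ∑ F L ≈ ∑ G L
  ∑-cong F≈G [] = ≈-refl
  ∑-cong F≈G (p ∷ L) = +-cong (F≈G p) (∑-cong F≈G L)

  ∑-++ : ∀ {A : Set} (F : A → Carrier) xs ys → ∑ F (xs List.++ ys) ≈ ∑ F xs + ∑ F ys
  ∑-++ F [] ys = ≈-sym (+-identityˡ _)
  ∑-++ F (x ∷ xs) ys = ≈-trans (+-congˡ (∑-++ F xs ys)) (≈-sym (+-assoc _ _ _))

  ∑-concatMap : ∀ {A B : Set} (F : B → Carrier) (g : A → List B) L → ∑ F (List.concatMap g L) ≈ ∑ (λ p → ∑ F (g p)) L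
  ∑-concatMap F g [] = ≈-refl
  ∑-concatMap F g (p ∷ L) = ≈-trans (∑-++ F (g p) (List.concatMap g L)) (+-congˡ (∑-concatMap F g L))

  ∑-+ : ∀ {A : Set} (F G : A → Carrier) L → ∑ (λ p → F p + G p) L ≈ ∑ F L + ∑ G L
  ∑-+ F G [] = ≈-sym (+-identityˡ _)
  ∑-+ F G (p ∷ L) = ≈-trans (+-congˡ (∑-+ F G L)) (CommSemigroupProps.interchange +-commutativeSemigroup _ _ _ _)

  *-distribˡ-∑ : ∀ {A : Set} a (F : A → Carrier) L → a * ∑ F L ≈ ∑ (λ p → a * F p) L
  *-distribˡ-∑ a F [] = zeroʳ a
  *-distribˡ-∑ a F (p ∷ L) = ≈-trans (distribˡ a (F p) (∑ F L)) (+-congˡ (*-distribˡ-∑ a F L))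

  *-distribʳ-∑ : ∀ {A : Set} a (F : A → Carrier) L → ∑ F L * a ≈ ∑ (λ p → F p * a) L
  *-distribʳ-∑ a F [] = zeroˡ a
  *-distribʳ-∑ a F (p ∷ L) = ≈-trans (distribʳ a (F p) (∑ F L)) (+-congˡ (*-distribʳ-∑ a F L))

  Pair : ℕ → Set
  Pair n = List (Subset n) × List (Subset n)

  withEdge : ∀ {n} (F : Pair n → Carrier) (e : Subset n) → Pair n → Carrier
  withEdge F e (A , B) = F (A , B) + (F (e ∷ A , B) + F (A , e ∷ B))

  ∑-pairs-∷ : ∀ {n} (F : Pair n → Carrier) e es → ∑ F (pairs (e ∷ es)) ≈ ∑ (withEdge F e) (pairs es)
  ∑-pairs-∷ F e es = ≈-trans (∑-concatMap F _ (pairs es))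
    (∑-cong (λ { (A , B) → +-congˡ (+-congˡ (+-identityʳ _)) }) (pairs es))

  ∑-pairs-cong : ∀ {n} (P : Subset n → Set) {F G : Pair n → Carrier} →
    (∀ A B → All P A → All P B → F (A , B) ≈ G (A , B)) → ∀ L → All P L → ∑ F (pairs L) ≈ ∑ G (pairs L)
  ∑-pairs-cong P F≈G [] _ = +-cong (F≈G [] [] [] []) ≈-refl
  ∑-pairs-cong P {F} {G} F≈G (e ∷ L) (Pe ∷ PL) = begin
    ∑ F (pairs (e ∷ L))          ≈⟨ ∑-pairs-∷ F e L ⟩
    ∑ (withEdge F e) (pairs L)   ≈⟨ ∑-pairs-cong P (λ A B PA PB → +-cong (F≈G A B PA PB)
                                      (+-cong (F≈G (e ∷ A) B (Pe ∷ PA) PB) (F≈G A (e ∷ B) PA (Pe ∷ PB)))) L PL ⟩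
    ∑ (withEdge G e) (pairs L)   ≈⟨ ≈-sym (∑-pairs-∷ G e L) ⟩
    ∑ G (pairs (e ∷ L))          ∎

  ∑-pairs-map : ∀ {m n} (f : Subset m → Subset n) (F : Pair n → Carrier) L →
    ∑ F (pairs (map f L)) ≈ ∑ (λ { (A , B) → F (map f A , map f B) }) (pairs L)
  ∑-pairs-map f F [] = ≈-refl
  ∑-pairs-map f F (e ∷ L) = ≈-trans (∑-pairs-∷ F (f e) (map f L))
    (≈-trans (∑-pairs-map f (withEdge F (f e)) L) (≈-sym (∑-pairs-∷ _ e L)))

  ∑-pairs-++ : ∀ {n} (F : Pair n → Carrier) xs ys → ∑ F (pairs (xs List.++ ys)) ≈
    ∑ (λ { (A₂ , B₂) → ∑ (λ { (A₁ , B₁) → F (A₁ List.++ A₂ , B₁ List.++ B₂) }) (pairs xs) }) (pairs ys)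
  ∑-pairs-++ F [] ys = ∑-cong (λ p → ≈-sym (+-identityʳ _)) (pairs ys)
  ∑-pairs-++ F (x ∷ xs) ys = ≈-trans (∑-pairs-∷ F x (xs List.++ ys))
    (≈-trans (∑-pairs-++ (withEdge F x) xs ys) (∑-cong (λ q → ≈-sym (∑-pairs-∷ _ x xs)) (pairs ys)))

  restrict : ∀ {n} → (Subset n → Bool) → (Pair n → Carrier) → Pair n → Carrier
  restrict q F (A , B) = if allᵇ q A ∧ allᵇ q B then F (A , B) else 0#

  ∑-pairs-filterᵇ : ∀ {n} (q : Subset n → Bool) (F : Pair n → Carrier) L →
    ∑ F (pairs (filterᵇ q L)) ≈ ∑ (restrict q F) (pairs L)
  ∑-pairs-filterᵇ q F [] = ≈-refl
  ∑-pairs-filterᵇ q F (x ∷ L) with q x in qx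
  ... | true = ≈-trans (∑-pairs-∷ F x (filterᵇ q L)) (≈-trans (∑-pairs-filterᵇ q (withEdge F x) L)
        (≈-trans (∑-cong kept (pairs L)) (≈-sym (∑-pairs-∷ (restrict q F) x L))))
    where
    kept : ∀ p → restrict q (withEdge F x) p ≈ withEdge (restrict q F) x p
    kept (A , B) rewrite qx with allᵇ q A | allᵇ q B
    ... | true | true = ≈-refl
    ... | true | false = ≈-sym (≈-trans (+-identityˡ _) (+-identityˡ _))
    ... | false | _ = ≈-sym (≈-trans (+-identityˡ _) (+-identityˡ _))
  ... | false = ≈-trans (∑-pairs-filterᵇ q F L) (≈-trans (∑-cong dropped (pairs L)) (≈-sym (∑-pairs-∷ (restrict q F) x L)))
    where
    dropped : ∀ p → restrict q F p ≈ withEdge (restrict q F) x p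
    dropped (A , B) rewrite qx with allᵇ q A | allᵇ q B
    ... | true | true = ≈-sym (≈-trans (+-congˡ (+-identityˡ _)) (+-identityʳ _))
    ... | true | false = ≈-sym (≈-trans (+-identityˡ _) (+-identityˡ _))
    ... | false | _ = ≈-sym (≈-trans (+-identityˡ _) (+-identityˡ _))

  PermutationInvariant : ∀ {n} → (Pair n → Carrier) → Set _
  PermutationInvariant F = ∀ {A A' B B'} → A ↭ A' → B ↭ B' → F (A , B) ≈ F (A' , B')

  withEdge-invariant : ∀ {n} (F : Pair n → Carrier) e → PermutationInvariant F → PermutationInvariant (withEdge F e)
  withEdge-invariant F e inv pA pB = +-cong (inv pA pB) (+-cong (inv (prep e pA) pB) (inv pA (prep e pB)))

  withEdge-comm : ∀ {n} (F : Pair n → Carrier) e₀ e → PermutationInvariant F →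
    ∀ p → withEdge (withEdge F e₀) e p ≈ withEdge (withEdge F e) e₀ p
  withEdge-comm F e₀ e inv (A , B) = begin
    (F₀ + (F (e₀ ∷ A , B) + F (A , e₀ ∷ B))) +
      ((F (e ∷ A , B) + (F (e₀ ∷ e ∷ A , B) + F (e ∷ A , e₀ ∷ B))) +
       (F (A , e ∷ B) + (F (e₀ ∷ A , e ∷ B) + F (A , e₀ ∷ e ∷ B))))
      ≈⟨ +-congˡ (+-cong (+-congˡ (+-congʳ (inv (swap e₀ e ↭-refl) ↭-refl)))
                         (+-congˡ (+-congˡ (inv ↭-refl (swap e₀ e ↭-refl))))) ⟩
    (F₀ + (F (e₀ ∷ A , B) + F (A , e₀ ∷ B))) +
      ((F (e ∷ A , B) + (F (e ∷ e₀ ∷ A , B) + F (e ∷ A , e₀ ∷ B))) +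
       (F (A , e ∷ B) + (F (e₀ ∷ A , e ∷ B) + F (A , e ∷ e₀ ∷ B))))
      ≈⟨ +-Solver.solve 9 (λ a b c d f g h i j →
           (a ⊕ (b ⊕ c)) ⊕ ((d ⊕ (f ⊕ g)) ⊕ (h ⊕ (i ⊕ j))) ⊜ (a ⊕ (d ⊕ h)) ⊕ ((b ⊕ (f ⊕ i)) ⊕ (c ⊕ (g ⊕ j))))
           ≈-refl F₀ _ _ _ _ _ _ _ _ ⟩
    (F₀ + (F (e ∷ A , B) + F (A , e ∷ B))) +
      ((F (e₀ ∷ A , B) + (F (e ∷ e₀ ∷ A , B) + F (e₀ ∷ A , e ∷ B))) +
       (F (A , e₀ ∷ B) + (F (e ∷ A , e₀ ∷ B) + F (A , e ∷ e₀ ∷ B)))) ∎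
    where
    F₀ = F (A , B)
    module +-Solver = CommMonoidSolver +-commutativeMonoid
    open +-Solver using (_⊕_; _⊜_)

  ∑-pairs-removeAt : ∀ {n} (F : Pair n → Carrier) → PermutationInvariant F → ∀ Es (i : Fin (length Es)) →
    ∑ F (pairs Es) ≈ ∑ (withEdge F (List.lookup Es i)) (pairs (List.removeAt Es i))
  ∑-pairs-removeAt F inv (e ∷ es) zero = ∑-pairs-∷ F e es
  ∑-pairs-removeAt F inv (e₀ ∷ es) (suc j) = begin
    ∑ F (pairs (e₀ ∷ es))                         ≈⟨ ∑-pairs-∷ F e₀ es ⟩
    ∑ (withEdge F e₀) (pairs es)                  ≈⟨ ∑-pairs-removeAt (withEdge F e₀) (withEdge-invariant F e₀ inv) es j ⟩
    ∑ (withEdge (withEdge F e₀) e) (pairs rest)   ≈⟨ ∑-cong (withEdge-comm F e₀ e inv) (pairs rest) ⟩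
    ∑ (withEdge (withEdge F e) e₀) (pairs rest)   ≈⟨ ≈-sym (∑-pairs-∷ (withEdge F e) e₀ rest) ⟩
    ∑ (withEdge F e) (pairs (e₀ ∷ rest))          ∎
    where
    e = List.lookup es j
    rest = List.removeAt es j

wellFormed⇒edges : ∀ (H : Hypergraph) → WellFormed H → All (IsEdgeOf (V H)) (E H)
wellFormed⇒edges H = All.zipWith isEdge
  where
  isEdge : ∀ {e} → e FinSubset.⊆ V H × FinSubset.Nonempty e → IsEdgeOf (V H) e
  isEdge {e} (e⊆V , v , v∈e) = (λ u eu → VecP.[]=⇒lookup (e⊆V (VecP.lookup⇒[]= u e eu))) , v , VecP.[]=⇒lookup v∈e

All-removeAt : ∀ {A : Set} {P : A → Set} {xs : List A} → All P xs → (i : Fin (length xs)) → All P (List.removeAt xs i)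
All-removeAt (px ∷ pxs) zero = pxs
All-removeAt (px ∷ pxs) (suc i) = px ∷ All-removeAt pxs i

∸-+-distrib : ∀ k₁ k₂ b₁ b₂ → b₁ ≤ k₁ → b₂ ≤ k₂ → (k₁ +ℕ k₂) ∸ (b₁ +ℕ b₂) ≡ (k₁ ∸ b₁) +ℕ (k₂ ∸ b₂)
∸-+-distrib k₁ k₂ b₁ b₂ b₁≤k₁ b₂≤k₂ = trans (sym (ℕP.∸-+-assoc (k₁ +ℕ k₂) b₁ b₂))
  (trans (cong (_∸ b₂) (ℕP.+-∸-comm k₂ b₁≤k₁)) (ℕP.+-∸-assoc (k₁ ∸ b₁) b₂≤k₂))

-- The hyperedge elimination polynomial

module Elimination {c ℓ} (R : CommutativeSemiring c ℓ) where
  open CommutativeSemiring R hiding (zero) renaming (refl to ≈-refl; sym to ≈-sym; trans to ≈-trans)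
  open Poly R
  open PairSums R
  open import Relation.Binary.Reasoning.Setoid setoid
  module *-Solver = CommMonoidSolver *-commutativeMonoid
  open *-Solver using (_⊕_; _⊜_)

  -- The summand of ξ for a pair with vertex disjointness b, k(H_{A⊔B}) = k, |A| + |B| = l and k(H×B) = kB.
  monomial : Carrier → Carrier → Carrier → Bool → ℕ → ℕ → ℕ → Carrier
  monomial x y z b k l kB = if b then pow x (k ∸ kB) * (pow y (l ∸ kB) * pow z kB) else 0#

  monomial-cong : ∀ x y z {b b' k k' l l' kB kB'} → b ≡ b' → k ≡ k' → l ≡ l' → kB ≡ kB' →
    monomial x y z b k l kB ≡ monomial x y z b' k' l' kB'
  monomial-cong x y z refl refl refl refl = refl

  pow-+ : ∀ a m k → pow a (m +ℕ k) ≈ pow a m * pow a k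
  pow-+ a zero k = ≈-sym (*-identityˡ _)
  pow-+ a (suc m) k = ≈-trans (*-congˡ (pow-+ a m k)) (≈-sym (*-assoc _ _ _))

  monomial-* : ∀ x y z b₁ b₂ k₁ k₂ l₁ l₂ kB₁ kB₂ →
    (b₁ ≡ true → kB₁ ≤ k₁ × kB₁ ≤ l₁) → (b₂ ≡ true → kB₂ ≤ k₂ × kB₂ ≤ l₂) →
    monomial x y z (b₁ ∧ b₂) (k₁ +ℕ k₂) (l₁ +ℕ l₂) (kB₁ +ℕ kB₂) ≈ monomial x y z b₁ k₁ l₁ kB₁ * monomial x y z b₂ k₂ l₂ kB₂
  monomial-* x y z false b₂ k₁ k₂ l₁ l₂ kB₁ kB₂ _ _ = ≈-sym (zeroˡ _)
  monomial-* x y z true false k₁ k₂ l₁ l₂ kB₁ kB₂ _ _ = ≈-sym (zeroʳ _)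
  monomial-* x y z true true k₁ k₂ l₁ l₂ kB₁ kB₂ bounds₁ bounds₂ = begin
    pow x ((k₁ +ℕ k₂) ∸ (kB₁ +ℕ kB₂)) * (pow y ((l₁ +ℕ l₂) ∸ (kB₁ +ℕ kB₂)) * pow z (kB₁ +ℕ kB₂))
      ≡⟨ cong₂ (λ p q → pow x p * (pow y q * pow z (kB₁ +ℕ kB₂)))
           (∸-+-distrib k₁ k₂ kB₁ kB₂ (proj₁ (bounds₁ refl)) (proj₁ (bounds₂ refl)))
           (∸-+-distrib l₁ l₂ kB₁ kB₂ (proj₂ (bounds₁ refl)) (proj₂ (bounds₂ refl))) ⟩
    pow x ((k₁ ∸ kB₁) +ℕ (k₂ ∸ kB₂)) * (pow y ((l₁ ∸ kB₁) +ℕ (l₂ ∸ kB₂)) * pow z (kB₁ +ℕ kB₂))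
      ≈⟨ *-cong (pow-+ x (k₁ ∸ kB₁) (k₂ ∸ kB₂)) (*-cong (pow-+ y (l₁ ∸ kB₁) (l₂ ∸ kB₂)) (pow-+ z kB₁ kB₂)) ⟩
    (pow x (k₁ ∸ kB₁) * pow x (k₂ ∸ kB₂)) * ((pow y (l₁ ∸ kB₁) * pow y (l₂ ∸ kB₂)) * (pow z kB₁ * pow z kB₂))
      ≈⟨ *-Solver.solve 6 (λ x₁ x₂ y₁ y₂ z₁ z₂ →
           (x₁ ⊕ x₂) ⊕ ((y₁ ⊕ y₂) ⊕ (z₁ ⊕ z₂)) ⊜ (x₁ ⊕ (y₁ ⊕ z₁)) ⊕ (x₂ ⊕ (y₂ ⊕ z₂))) ≈-refl _ _ _ _ _ _ ⟩
    (pow x (k₁ ∸ kB₁) * (pow y (l₁ ∸ kB₁) * pow z kB₁)) * (pow x (k₂ ∸ kB₂) * (pow y (l₂ ∸ kB₂) * pow z kB₂)) ∎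

  monomial-suc-length : ∀ x y z k l kB → kB ≤ l → monomial x y z true k (suc l) kB ≈ y * monomial x y z true k l kB
  monomial-suc-length x y z k l kB kB≤l = begin
    pow x (k ∸ kB) * (pow y (suc l ∸ kB) * pow z kB)
      ≡⟨ cong (λ m → pow x (k ∸ kB) * (pow y m * pow z kB)) (ℕP.+-∸-assoc 1 kB≤l) ⟩
    pow x (k ∸ kB) * ((y * pow y (l ∸ kB)) * pow z kB)
      ≈⟨ *-Solver.solve 4 (λ a b c d → a ⊕ ((b ⊕ c) ⊕ d) ⊜ b ⊕ (a ⊕ (c ⊕ d))) ≈-refl _ y _ _ ⟩
    y * (pow x (k ∸ kB) * (pow y (l ∸ kB) * pow z kB)) ∎

  monomial-suc-all : ∀ x y z k l kB → monomial x y z true (suc k) (suc l) (suc kB) ≈ z * monomial x y z true k l kB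
  monomial-suc-all x y z k l kB =
    *-Solver.solve 4 (λ a b c d → a ⊕ (b ⊕ (c ⊕ d)) ⊜ c ⊕ (a ⊕ (b ⊕ d))) ≈-refl (pow x (k ∸ kB)) (pow y (l ∸ kB)) z (pow z kB)

  ξ-E₀ : ∀ x y z → ξ E₀ x y z ≈ 1#
  ξ-E₀ x y z = ≈-trans (+-identityʳ _) (≈-trans (*-identityˡ _) (*-identityˡ _))

  ξ-E₁ : ∀ x y z → ξ E₁ x y z ≈ x
  ξ-E₁ x y z = ≈-trans (+-identityʳ _) (≈-trans (*-cong (*-identityʳ x) (*-identityˡ 1#)) (*-identityʳ x))

  term-invariant : ∀ {n} (W : Subset n) x y z → PermutationInvariant (term W x y z)
  term-invariant W x y z {A} {A'} {B} {B'} pA pB = reflexive (monomial-cong x y z (vertexDisjoint-↭ pA pB)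
    (kComp-resp-↭ W pAB) (PermP.↭-length pAB) (trans (cong (λ U → kComp U B) (bigUnion-↭ pB)) (kComp-resp-↭ (bigUnion B') pB)))
    where pAB = PermP.++⁺ pA pB

  exponent-bounds : ∀ {n} (W : Subset n) A B → All (IsEdgeOf W) B → vertexDisjoint A B ≡ true →
    kComp (bigUnion B) B ≤ kComp W (A List.++ B) × kComp (bigUnion B) B ≤ length (A List.++ B)
  exponent-bounds W A B B-edges disjoint =
    kComp-bigUnion≤kComp W A B (All.map proj₁ B-edges) disjoint ,
    ℕP.≤-trans (kComp-bigUnion≤length B (All.map proj₂ B-edges)) (ListP.length-++-≤ʳ B {A})

  term-⊔ᴱ : ∀ {n₁ n₂} (V₁ : Subset n₁) (V₂ : Subset n₂) x y z A₁ B₁ A₂ B₂ → All (IsEdgeOf V₁) B₁ → All (IsEdgeOf V₂) B₂ →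
    term (V₁ ++ V₂) x y z (A₁ ⊔ᴱ A₂ , B₁ ⊔ᴱ B₂) ≈ term V₁ x y z (A₁ , B₁) * term V₂ x y z (A₂ , B₂)
  term-⊔ᴱ {n₁} {n₂} V₁ V₂ x y z A₁ B₁ A₂ B₂ B₁-edges B₂-edges = begin
    term (V₁ ++ V₂) x y z (A₁ ⊔ᴱ A₂ , B₁ ⊔ᴱ B₂)
      ≡⟨ monomial-cong x y z (vertexDisjoint-⊔ᴱ A₁ B₁ A₂ B₂) (kComp-⊔ᴱ-pair V₁ V₂ A₁ B₁ A₂ B₂) (length-⊔ᴱ-pair A₁ B₁ A₂ B₂) (kComp-bigUnion-⊔ᴱ B₁ B₂) ⟩
    monomial x y z (vertexDisjoint A₁ B₁ ∧ vertexDisjoint A₂ B₂) (kComp V₁ (A₁ List.++ B₁) +ℕ kComp V₂ (A₂ List.++ B₂))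
      (length (A₁ List.++ B₁) +ℕ length (A₂ List.++ B₂)) (kComp (bigUnion B₁) B₁ +ℕ kComp (bigUnion B₂) B₂)
      ≈⟨ monomial-* x y z _ _ _ _ _ _ _ _ (exponent-bounds V₁ A₁ B₁ B₁-edges) (exponent-bounds V₂ A₂ B₂ B₂-edges) ⟩
    term V₁ x y z (A₁ , B₁) * term V₂ x y z (A₂ , B₂) ∎

  ξ-⊔ᴴ : ∀ x y z (H₁ H₂ : Hypergraph) → WellFormed H₁ → WellFormed H₂ → ξ (H₁ ⊔ᴴ H₂) x y z ≈ ξ H₁ x y z * ξ H₂ x y z
  ξ-⊔ᴴ x y z H₁@(hg n₁ V₁ E₁) H₂@(hg n₂ V₂ E₂) wf₁ wf₂ = begin
    ξ (H₁ ⊔ᴴ H₂) x y z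
      ≈⟨ ∑-pairs-++ (term (V₁ ++ V₂) x y z) (map (embedˡ n₂) E₁) (map (embedʳ n₁) E₂) ⟩
    ∑ (λ { (A₂' , B₂') → ∑ (λ { (A₁' , B₁') → term (V₁ ++ V₂) x y z (A₁' List.++ A₂' , B₁' List.++ B₂') }) (pairs (map (embedˡ n₂) E₁)) })
      (pairs (map (embedʳ n₁) E₂))
      ≈⟨ ≈-trans (∑-cong (λ _ → ∑-pairs-map (embedˡ n₂) _ E₁) (pairs (map (embedʳ n₁) E₂))) (∑-pairs-map (embedʳ n₁) _ E₂) ⟩
    ∑ (λ { (A₂ , B₂) → ∑ (λ { (A₁ , B₁) → term (V₁ ++ V₂) x y z (A₁ ⊔ᴱ A₂ , B₁ ⊔ᴱ B₂) }) (pairs E₁) }) (pairs E₂)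
      ≈⟨ ∑-pairs-cong (IsEdgeOf V₂) (λ A₂ B₂ _ B₂-edges → ∑-pairs-cong (IsEdgeOf V₁)
           (λ A₁ B₁ _ B₁-edges → term-⊔ᴱ V₁ V₂ x y z A₁ B₁ A₂ B₂ B₁-edges B₂-edges) E₁ (wellFormed⇒edges H₁ wf₁))
           E₂ (wellFormed⇒edges H₂ wf₂) ⟩
    ∑ (λ p₂ → ∑ (λ p₁ → term V₁ x y z p₁ * term V₂ x y z p₂) (pairs E₁)) (pairs E₂)
      ≈⟨ ∑-cong (λ p₂ → ≈-sym (*-distribʳ-∑ (term V₂ x y z p₂) (term V₁ x y z) (pairs E₁))) (pairs E₂) ⟩
    ∑ (λ p₂ → ξ H₁ x y z * term V₂ x y z p₂) (pairs E₂)
      ≈⟨ ≈-sym (*-distribˡ-∑ (ξ H₁ x y z) (term V₂ x y z) (pairs E₂)) ⟩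
    ξ H₁ x y z * ξ H₂ x y z ∎

  module PlacingAnEdge {n} (W e : Subset n) (v₀ : Fin n) (ev₀ : lookup e v₀ ≡ true) (e⊆W : e ⊆ᵇ W) (x y z : Carrier)
                       (A B : List (Subset n)) (A-edges : All (IsEdgeOf W) A) (B-edges : All (IsEdgeOf W) B) where

    W/ : Subset (suc n)
    W/ = true ∷ (W ∖ᵇ e)

    A/ B/ : List (Subset (suc n))
    A/ = map (contractEdge e) A
    B/ = map (contractEdge e) B

    l = length (A List.++ B)
    k/ = kComp W/ (A/ List.++ B/)
    k† = kComp (W ∖ᵇ e) (A List.++ B)
    kB = kComp (bigUnion B) B
    kB/ = kComp (bigUnion B/) B/
    kB+e = kComp (bigUnion (e ∷ B)) (e ∷ B)
    d = vertexDisjoint A B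

    kComp-e∷ : kComp W (e ∷ (A List.++ B)) ≡ k/
    kComp-e∷ = trans (Contraction.kComp-contract W e (A List.++ B) v₀ ev₀ e⊆W (λ g∈ → proj₁ (All.lookup (AllP.++⁺ A-edges B-edges) g∈)))
                     (cong (kComp W/) (ListP.map-++ (contractEdge e) A B))

    kComp-∷B : kComp W (A List.++ e ∷ B) ≡ k/
    kComp-∷B = trans (kComp-resp-↭ W (PermP.shift e A B)) kComp-e∷

    kB≤l : kB ≤ l
    kB≤l = ℕP.≤-trans (kComp-bigUnion≤length B (All.map proj₂ B-edges)) (ListP.length-++-≤ʳ B {A})

    kB/≤l : kB/ ≤ l
    kB/≤l = ℕP.≤-trans (kComp-bigUnion≤length B/ (AllP.map⁺ (All.map (λ {g} g-edge → proj₂ (contractEdge-isEdgeOf {W = W} {e} {g} g-edge)) B-edges)))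
              (ℕP.≤-trans (ℕP.≤-reflexive (ListP.length-map (contractEdge e) B)) (ListP.length-++-≤ʳ B {A}))

    in-A : term W x y z (e ∷ A , B) ≡ monomial x y z (avoids e B ∧ d) k/ (suc l) kB
    in-A = monomial-cong x y z {k = kComp W (e ∷ (A List.++ B))} {l = suc l} {kB = kB} (vertexDisjoint-∷ˡ e A B) kComp-e∷ refl refl

    in-B : term W x y z (A , e ∷ B) ≡ monomial x y z (avoids e A ∧ d) k/ (suc l) kB+e
    in-B = monomial-cong x y z {k = kComp W (A List.++ e ∷ B)} {l = length (A List.++ e ∷ B)} {kB = kB+e} (vertexDisjoint-∷ʳ e A B) kComp-∷B (ListP.length-++-sucʳ A e B) refl

    contracted : term W/ x y z (A/ , B/) ≡ monomial x y z ((avoids e A ∨ avoids e B) ∧ d) k/ l kB/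
    contracted = monomial-cong x y z {k = k/} {l = length (A/ List.++ B/)} {kB = kB/} (vertexDisjoint-contractEdge e A B) refl
      (trans (sym (cong length (ListP.map-++ (contractEdge e) A B))) (ListP.length-map (contractEdge e) (A List.++ B))) refl

    in-A-avoiding : avoids e B ≡ true → monomial x y z true k/ (suc l) kB ≈ y * monomial x y z true k/ l kB/
    in-A-avoiding avB = ≈-trans (reflexive (monomial-cong x y z {b = true} {k = k/} {l = suc l} refl refl refl (sym kB/≡kB))) (monomial-suc-length x y z k/ l kB/ (ℕP.≤-trans (ℕP.≤-reflexive kB/≡kB) kB≤l))
      where kB/≡kB = kComp-bigUnion-contractEdge-avoiding e B avB

    in-B-meeting : avoids e B ≡ false → monomial x y z true k/ (suc l) kB+e ≈ y * monomial x y z true k/ l kB/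
    in-B-meeting meetsB = ≈-trans (reflexive (monomial-cong x y z {b = true} {k = k/} {l = suc l} refl refl refl (kComp-bigUnion-∷-meeting e v₀ ev₀ B meetsB)))
                                  (monomial-suc-length x y z k/ l kB/ kB/≤l)

    -- If no edge meets e, then e becomes an extra component both of H_{A⊔B⊔e} and of H × (B ⊔ e).
    in-B-avoiding : avoids e A ≡ true → avoids e B ≡ true → monomial x y z true k/ (suc l) kB+e ≈ z * monomial x y z true k† l kB
    in-B-avoiding avA avB = ≈-trans (reflexive (monomial-cong x y z {b = true} {l = suc l} refl k/≡1+k† refl (kComp-bigUnion-∷-avoiding e v₀ ev₀ B avB)))
                                    (monomial-suc-all x y z k† l kB)
      where
      k/≡1+k† : k/ ≡ suc k†
      k/≡1+k† = trans (cong₂ (λ X Y → kComp W/ (X List.++ Y)) (contractEdge-avoiding e A avA) (contractEdge-avoiding e B avB))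
                  (trans (cong (kComp W/) (sym (ListP.map-++ (false ∷_) A B))) (kComp-freshVertex true (W ∖ᵇ e) (A List.++ B)))

    zeros : 0# + 0# ≈ y * 0# + z * 0#
    zeros = ≈-sym (+-cong (zeroʳ y) (zeroʳ z))

    by-cases : ∀ a b d' → avoids e A ≡ a → avoids e B ≡ b → d ≡ d' →
      monomial x y z (b ∧ d') k/ (suc l) kB + monomial x y z (a ∧ d') k/ (suc l) kB+e
        ≈ y * monomial x y z ((a ∨ b) ∧ d') k/ l kB/ + z * (if a ∧ b then monomial x y z d' k† l kB else 0#)
    by-cases true true true avA avB _ = +-cong (in-A-avoiding avB) (in-B-avoiding avA avB)
    by-cases false true true _ avB _ = +-cong (in-A-avoiding avB) (≈-sym (zeroʳ z))
    by-cases true false true _ meetsB _ = ≈-trans (+-identityˡ _) (≈-trans (in-B-meeting meetsB) (≈-sym (≈-trans (+-congˡ (zeroʳ z)) (+-identityʳ _))))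
    by-cases false false true _ _ _ = zeros
    by-cases true true false _ _ _ = zeros
    by-cases true false false _ _ _ = zeros
    by-cases false true false _ _ _ = zeros
    by-cases false false false _ _ _ = zeros

    placed-terms : term W x y z (e ∷ A , B) + term W x y z (A , e ∷ B)
      ≈ y * term W/ x y z (A/ , B/) + z * restrict (λ f → not (meets f e)) (term (W ∖ᵇ e) x y z) (A , B)
    placed-terms = ≈-trans (reflexive (cong₂ _+_ in-A in-B))
      (≈-trans (by-cases (avoids e A) (avoids e B) d refl refl refl) (reflexive (cong (λ t → y * t + z * restrict (λ f → not (meets f e)) (term (W ∖ᵇ e) x y z) (A , B)) (sym contracted))))

  ξ-delete-contract-extract : ∀ x y z (H : Hypergraph) → WellFormed H → (i : EdgeIx H) →
    ξ H x y z ≈ (ξ (delete H i) x y z + y * ξ (contract H i) x y z) + z * ξ (extract H i) x y z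
  ξ-delete-contract-extract x y z H@(hg n W Es) wf i = begin
    ∑ T (pairs Es)
      ≈⟨ ∑-pairs-removeAt T (term-invariant W x y z) Es i ⟩
    ∑ (withEdge T e) (pairs rest)
      ≈⟨ ∑-pairs-cong (IsEdgeOf W) (λ A B A-edges B-edges → +-congˡ (PlacingAnEdge.placed-terms W e v₀ ev₀ e⊆W x y z A B A-edges B-edges))
                     rest (All-removeAt edges i) ⟩
    ∑ (λ p → T p + (Y p + Z p)) (pairs rest)
      ≈⟨ ≈-trans (∑-+ T _ (pairs rest)) (+-congˡ (∑-+ Y Z (pairs rest))) ⟩
    ∑ T (pairs rest) + (∑ Y (pairs rest) + ∑ Z (pairs rest))
      ≈⟨ ≈-sym (+-assoc _ _ _) ⟩
    (ξ (delete H i) x y z + ∑ Y (pairs rest)) + ∑ Z (pairs rest)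
      ≈⟨ +-cong (+-congˡ (≈-sym (≈-trans (*-congˡ (∑-pairs-map (contractEdge e) T/ rest)) (*-distribˡ-∑ y _ (pairs rest)))))
                (≈-sym (≈-trans (*-congˡ (∑-pairs-filterᵇ q T† rest)) (*-distribˡ-∑ z _ (pairs rest)))) ⟩
    (ξ (delete H i) x y z + y * ξ (contract H i) x y z) + z * ξ (extract H i) x y z ∎
    where
    e = List.lookup Es i
    rest = List.removeAt Es i
    T = term W x y z
    T/ = term (true ∷ (W ∖ᵇ e)) x y z
    T† = term (W ∖ᵇ e) x y z
    q : Subset n → Bool
    q f = not (meets f e)
    edges = wellFormed⇒edges H wf
    e-edge = All.lookup edges (∈-lookup i)
    e⊆W = proj₁ e-edge
    v₀ = proj₁ (proj₂ e-edge)
    ev₀ = proj₂ (proj₂ e-edge)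
    Y Z : Pair n → Carrier
    Y (A , B) = y * T/ (map (contractEdge e) A , map (contractEdge e) B)
    Z p = z * restrict q T† p

mainTheorem9 : ∀ {c ℓ : Level} (R : CommutativeSemiring c ℓ) →
    let open CommutativeSemiring R in
    let open Poly R in
    (x y z : Carrier) →
      (ξ E₀ x y z ≈ 1#)
    × (ξ E₁ x y z ≈ x)
    × (∀ (H₁ H₂ : Hypergraph) → WellFormed H₁ → WellFormed H₂ →
         ξ (H₁ ⊔ᴴ H₂) x y z ≈ ξ H₁ x y z * ξ H₂ x y z)
    × (∀ (H : Hypergraph) → WellFormed H → (i : EdgeIx H) →
         ξ H x y z ≈ (ξ (delete H i) x y z + y * ξ (contract H i) x y z)
                      + z * ξ (extract H i) x y z)
mainTheorem9 R x y z = ξ-E₀ x y z , ξ-E₁ x y z , ξ-⊔ᴴ x y z , ξ-delete-contract-extract x y z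
  where open Elimination R
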